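{- Four points $\alpha,\beta,\gamma,\delta\in\widehat{\mathbb{Q}}(\sigma)$ are the vertices of one fundamental tetrahedron if and only if they are of the form $$\frac{p}{q},\quad\frac{r}{s},\quad\frac{p+r}{q+s},\quad\frac{p+\sigma r}{q+\sigma s},$$ where $p,q,r,s\in\mathbb{Z}[\sigma]$ satisfy $|ps-qr|=1$.
   Context: Let $\sigma=e^{i\pi/3}=\frac{1+i\sqrt3}{2}$, $\mathbb{Z}[\sigma]$ the Eisenstein integers, $\mathbb{Q}(\sigma)$ its fraction field and $\widehat{\mathbb{Q}}(\sigma)=\mathbb{Q}(\sigma)\cup\{\infty\}$ (with $p/0=\infty$ for $p\neq0$). In the upper half-space model of $\mathbb{H}^3$ (boundary $\widehat{\mathbb{C}}$), let $T$ be the regular ideal tetrahedron with vertices $0,1,\sigma,\infty$ and $H$ the group generated by reflections in the faces of $T$; the images $hT$, $h\in H$, are the fundamental tetrahedra; they tile $\mathbb{H}^3$ and their vertex set is $\widehat{\mathbb{Q}}(\sigma)$. -}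

module Defs where

open import Data.Integer using (ℤ; +_; -[1+_]; _+_; _*_; -_; _-_)
open import Data.Product using (_×_; _,_; proj₁; proj₂)
open import Data.List using (List; []; _∷_)
open import Data.List.Relation.Unary.All using (All)
open import Data.List.Relation.Unary.Any using (Any)
open import Data.Fin using (Fin; zero; suc)
open import Relation.Binary.PropositionalEquality using (_≡_)
open import Relation.Nullary using (¬_)

-- Eisenstein integers ℤ[σ], σ = e^{iπ/3}, σ² = σ - 1.
-- An element  a + b σ  is represented as  mk a b.

record ℤσ : Set where
  constructor mk
  field
    re : ℤ
    im : ℤ
open ℤσ public

0σ 1σ σ′ : ℤσ
0σ = mk (+ 0) (+ 0)
1σ = mk (+ 1) (+ 0)
σ′ = mk (+ 0) (+ 1)

infixl 6 _+σ_ _-σ_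
infixl 7 _*σ_

_+σ_ : ℤσ → ℤσ → ℤσ
mk a b +σ mk c d = mk (a + c) (b + d)

-σ_ : ℤσ → ℤσ
-σ mk a b = mk (- a) (- b)

_-σ_ : ℤσ → ℤσ → ℤσ
x -σ y = x +σ (-σ y)

-- (a + bσ)(c + dσ) = (ac - bd) + (ad + bc + bd)σ   using σ² = σ - 1
_*σ_ : ℤσ → ℤσ → ℤσ
mk a b *σ mk c d = mk (a * c - b * d) (a * d + b * c + b * d)

-- complex conjugation: conj σ = 1 - σ
conj : ℤσ → ℤσ
conj (mk a b) = mk (a + b) (- b)

-- |a + bσ|² = a² + ab + b²
norm : ℤσ → ℤ
norm (mk a b) = a * a + a * b + b * b

-- The extended field  Q̂(σ) = Q(σ) ∪ {∞}  as the projective line over Q(σ):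
-- a point p/q is a pair (p , q) of Eisenstein integers, not both zero
-- (q = 0 giving ∞); two pairs denote the same point iff p q' = q p'.

Pair : Set
Pair = ℤσ × ℤσ

IsPoint : Pair → Set
IsPoint (p , q) = ¬ ((p ≡ 0σ) × (q ≡ 0σ))

infix 4 _≈P_
_≈P_ : Pair → Pair → Set
(p , q) ≈P (p′ , q′) = p *σ q′ ≡ q *σ p′

pt0 pt1 ptσ pt∞ : Pair
pt0 = (0σ , 1σ)
pt1 = (1σ , 1σ)
ptσ = (σ′ , 1σ)
pt∞ = (1σ , 0σ)

-- Reflections in the faces of T, acting on the boundary as
-- anti-Möbius maps  z ↦ (a z̄ + b)/(c z̄ + d), i.e. on pairs
-- (p , q) ↦ (a p̄ + b q̄ , c p̄ + d q̄).
--   face (0,1,∞):  z ↦ z̄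
--   face (0,σ,∞):  z ↦ σ² z̄            (σ² = σ - 1)
--   face (1,σ,∞):  z ↦ (1+σ) - σ z̄
--   face (0,1,σ):  inversion in the circle through 0,1,σ
--                  (centre (1+σ)/3, radius² 1/3):
--                  z ↦ (1+σ) z̄ / (3 z̄ + (σ - 2))

antiMöbius : ℤσ → ℤσ → ℤσ → ℤσ → Pair → Pair
antiMöbius a b c d (p , q) =
  (a *σ conj p +σ b *σ conj q , c *σ conj p +σ d *σ conj q)

reflection : Fin 4 → Pair → Pair
reflection zero = antiMöbius 1σ 0σ 0σ 1σ
reflection (suc zero) = antiMöbius (mk (-[1+ 0 ]) (+ 1)) 0σ 0σ 1σ
reflection (suc (suc zero)) = antiMöbius (mk (+ 0) (-[1+ 0 ])) (mk (+ 1) (+ 1)) 0σ 1σ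
reflection (suc (suc (suc zero))) = antiMöbius (mk (+ 1) (+ 1)) 0σ (mk (+ 3) (+ 0)) (mk (-[1+ 1 ]) (+ 1))

-- Elements of H: words in the generating reflections
-- (each generator is an involution, so words give the whole group).
Word : Set
Word = List (Fin 4)

act : Word → Pair → Pair
act [] x = x
act (i ∷ w) x = reflection i (act w x)

_∈P_ : Pair → List Pair → Set
x ∈P ys = Any (x ≈P_) ys

SameSet : List Pair → List Pair → Set
SameSet xs ys = All (_∈P ys) xs × All (_∈P xs) ys

-- α, β, γ, δ are the vertices of one fundamental tetrahedron hT, h ∈ H
-- (the vertices of hT are the images under h of 0, 1, σ, ∞).
FundamentalTetrahedron : Pair → Pair → Pair → Pair → Set
FundamentalTetrahedron α β γ δ =
  Data.Product.Σ Word λ h →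
    SameSet (α ∷ β ∷ γ ∷ δ ∷ [])
            (act h pt0 ∷ act h pt1 ∷ act h ptσ ∷ act h pt∞ ∷ [])

{-# OPTIONS --safe #-}

-- A fundamental tetrahedron hT is the image of T under z ↦ M z or z ↦ M z̄ for a matrix M over ℤ[σ]
-- with unit determinant (every face reflection has this form), so its vertices are M0 = p/q, M∞ = r/s,
-- M1 = (p + r)/(q + s) and Mσ = (p + σ r)/(q + σ s) with |ps - qr| = 1. Conversely, column operations
-- with unit multipliers run the Euclidean algorithm of ℤ[σ] on the bottom row of such a matrix
-- (division with unit quotients suffices, the six units being 60° apart), which writes it as a product
-- of elementary matrices, each an explicit word in the face reflections and the symmetries of T. The
-- symmetries of T normalise H, so such a word is h followed by a symmetry of T; as the latter permutes
-- the vertices of T, the frame of the matrix is the vertex set of hT.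

module Submission where

open import Defs
open import Data.Integer as ℤ using (ℤ; +_; -[1+_]; ∣_∣)
import Data.Integer.Properties as ℤ
import Data.Integer.Tactic.RingSolver as ℤ-Solver
open import Data.Nat using (ℕ; _+_; _*_; _≤_; _<_; z≤n; s≤s)
import Data.Nat.Properties as ℕ
import Data.Nat.Tactic.RingSolver as ℕ-Solver
open import Data.Nat.Induction using (<-wellFounded)
open import Induction.WellFounded using (Acc; acc)
open import Data.Bool using (Bool; true; false; not)
open import Data.Fin using (Fin; zero; suc)
open import Data.Product using (Σ; _×_; _,_; proj₁; proj₂)
open import Data.Sum as Sum using (_⊎_; inj₁; inj₂)
open import Data.Empty using (⊥; ⊥-elim)
open import Data.Maybe using (Maybe; just; nothing)
open import Data.List using (List; []; _∷_; map; _++_)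
open import Data.List.Relation.Unary.All as All using (All; []; _∷_)
import Data.List.Relation.Unary.All.Properties as All
open import Data.List.Relation.Unary.Any as Any using (Any; here; there)
import Data.List.Relation.Unary.Any.Properties as Any
open import Data.List.Relation.Binary.Pointwise using (Pointwise; []; _∷_)
import Data.List.Relation.Binary.Pointwise.Properties as Pointwise
open import Data.List.Relation.Binary.Permutation.Propositional using (_↭_; prep; swap; ↭-sym)
  renaming (refl to ↭-refl; trans to ↭-trans)
open import Data.List.Relation.Binary.Permutation.Propositional.Properties using (∈-resp-↭; shift)
open import Relation.Binary.PropositionalEquality
open ≡-Reasoning
open import Relation.Binary.Definitions using (DecidableEquality)
open import Relation.Nullary using (¬_; Dec; yes; no)
open import Relation.Nullary.Negation using (contradiction)
open import Algebra.Bundles using (CommutativeRing)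
open import Tactic.RingSolver using (solve-∀)
open import Tactic.RingSolver.Core.AlmostCommutativeRing using (AlmostCommutativeRing; fromCommutativeRing)
open import Function.Base using (_∘_)
open import Function.Bundles using (_⇔_; mk⇔)

mk-cong : ∀ {a b c d} → a ≡ c → b ≡ d → mk a b ≡ mk c d
mk-cong refl refl = refl

_≟σ_ : DecidableEquality ℤσ
mk a b ≟σ mk c d with a ℤ.≟ c | b ℤ.≟ d
... | yes refl | yes refl = yes refl
... | no a≢c   | _        = no λ e → a≢c (cong re e)
... | _        | no b≢d   = no λ e → b≢d (cong im e)

*σ-assoc : ∀ x y z → (x *σ y) *σ z ≡ x *σ (y *σ z)
*σ-assoc (mk a b) (mk c d) (mk e f) = mk-cong (re-assoc a b c d e f) (im-assoc a b c d e f)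
  where
  re-assoc : ∀ a b c d e f →
    (a ℤ.* c ℤ.- b ℤ.* d) ℤ.* e ℤ.- (a ℤ.* d ℤ.+ b ℤ.* c ℤ.+ b ℤ.* d) ℤ.* f ≡
    a ℤ.* (c ℤ.* e ℤ.- d ℤ.* f) ℤ.- b ℤ.* (c ℤ.* f ℤ.+ d ℤ.* e ℤ.+ d ℤ.* f)
  re-assoc = ℤ-Solver.solve-∀
  im-assoc : ∀ a b c d e f →
    (a ℤ.* c ℤ.- b ℤ.* d) ℤ.* f ℤ.+ (a ℤ.* d ℤ.+ b ℤ.* c ℤ.+ b ℤ.* d) ℤ.* e
      ℤ.+ (a ℤ.* d ℤ.+ b ℤ.* c ℤ.+ b ℤ.* d) ℤ.* f ≡
    a ℤ.* (c ℤ.* f ℤ.+ d ℤ.* e ℤ.+ d ℤ.* f) ℤ.+ b ℤ.* (c ℤ.* e ℤ.- d ℤ.* f)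
      ℤ.+ b ℤ.* (c ℤ.* f ℤ.+ d ℤ.* e ℤ.+ d ℤ.* f)
  im-assoc = ℤ-Solver.solve-∀

*σ-comm : ∀ x y → x *σ y ≡ y *σ x
*σ-comm (mk a b) (mk c d) = mk-cong (re-comm a b c d) (im-comm a b c d)
  where
  re-comm : ∀ a b c d → a ℤ.* c ℤ.- b ℤ.* d ≡ c ℤ.* a ℤ.- d ℤ.* b
  re-comm = ℤ-Solver.solve-∀
  im-comm : ∀ a b c d → a ℤ.* d ℤ.+ b ℤ.* c ℤ.+ b ℤ.* d ≡ c ℤ.* b ℤ.+ d ℤ.* a ℤ.+ d ℤ.* b
  im-comm = ℤ-Solver.solve-∀

*σ-identityˡ : ∀ x → 1σ *σ x ≡ x
*σ-identityˡ (mk a b) = mk-cong (re-identity a b) (im-identity a b)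
  where
  re-identity : ∀ a b → + 1 ℤ.* a ℤ.- + 0 ℤ.* b ≡ a
  re-identity = ℤ-Solver.solve-∀
  im-identity : ∀ a b → + 1 ℤ.* b ℤ.+ + 0 ℤ.* a ℤ.+ + 0 ℤ.* b ≡ b
  im-identity = ℤ-Solver.solve-∀

*σ-distribˡ-+σ : ∀ x y z → x *σ (y +σ z) ≡ x *σ y +σ x *σ z
*σ-distribˡ-+σ (mk a b) (mk c d) (mk e f) = mk-cong (re-distrib a b c d e f) (im-distrib a b c d e f)
  where
  re-distrib : ∀ a b c d e f →
    a ℤ.* (c ℤ.+ e) ℤ.- b ℤ.* (d ℤ.+ f) ≡ (a ℤ.* c ℤ.- b ℤ.* d) ℤ.+ (a ℤ.* e ℤ.- b ℤ.* f)
  re-distrib = ℤ-Solver.solve-∀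
  im-distrib : ∀ a b c d e f →
    a ℤ.* (d ℤ.+ f) ℤ.+ b ℤ.* (c ℤ.+ e) ℤ.+ b ℤ.* (d ℤ.+ f) ≡
    (a ℤ.* d ℤ.+ b ℤ.* c ℤ.+ b ℤ.* d) ℤ.+ (a ℤ.* f ℤ.+ b ℤ.* e ℤ.+ b ℤ.* f)
  im-distrib = ℤ-Solver.solve-∀

ℤσ-commutativeRing : CommutativeRing _ _
ℤσ-commutativeRing = record
  { Carrier = ℤσ ; _≈_ = _≡_ ; _+_ = _+σ_ ; _*_ = _*σ_ ; -_ = -σ_ ; 0# = 0σ ; 1# = 1σ
  ; isCommutativeRing = record
    { isRing = record
      { +-isAbelianGroup = record
        { isGroup = record
          { isMonoid = record
            { isSemigroup = record
              { isMagma = record { isEquivalence = isEquivalence ; ∙-cong = cong₂ _+σ_ }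
              ; assoc = λ { (mk a b) (mk c d) (mk e f) → mk-cong (ℤ.+-assoc a c e) (ℤ.+-assoc b d f) } }
            ; identity = (λ { (mk a b) → mk-cong (ℤ.+-identityˡ a) (ℤ.+-identityˡ b) })
                       , (λ { (mk a b) → mk-cong (ℤ.+-identityʳ a) (ℤ.+-identityʳ b) }) }
          ; inverse = (λ { (mk a b) → mk-cong (ℤ.+-inverseˡ a) (ℤ.+-inverseˡ b) })
                    , (λ { (mk a b) → mk-cong (ℤ.+-inverseʳ a) (ℤ.+-inverseʳ b) })
          ; ⁻¹-cong = cong (-σ_) }
        ; comm = λ { (mk a b) (mk c d) → mk-cong (ℤ.+-comm a c) (ℤ.+-comm b d) } }
      ; *-cong = cong₂ _*σ_
      ; *-assoc = *σ-assoc
      ; *-identity = *σ-identityˡ , λ x → trans (*σ-comm x 1σ) (*σ-identityˡ x)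
      ; distrib = *σ-distribˡ-+σ , λ x y z → trans (*σ-comm (y +σ z) x)
          (trans (*σ-distribˡ-+σ x y z) (cong₂ _+σ_ (*σ-comm x y) (*σ-comm x z))) }
    ; *-comm = *σ-comm } }

ℤσ-ring : AlmostCommutativeRing _ _
ℤσ-ring = fromCommutativeRing ℤσ-commutativeRing is-zero?
  where
  is-zero? : ∀ x → Maybe (0σ ≡ x)
  is-zero? x with 0σ ≟σ x
  ... | yes e = just e
  ... | no _  = nothing

fromℤ : ℤ → ℤσ
fromℤ n = mk n (+ 0)

fromℤ-injective : ∀ {m n} → fromℤ m ≡ fromℤ n → m ≡ n
fromℤ-injective = cong re

fromℤ-* : ∀ m n → fromℤ (m ℤ.* n) ≡ fromℤ m *σ fromℤ n
fromℤ-* m n = mk-cong (re-* m n) (im-* m n)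
  where
  re-* : ∀ m n → m ℤ.* n ≡ m ℤ.* n ℤ.- + 0 ℤ.* + 0
  re-* = ℤ-Solver.solve-∀
  im-* : ∀ m n → + 0 ≡ m ℤ.* + 0 ℤ.+ + 0 ℤ.* n ℤ.+ + 0 ℤ.* + 0
  im-* = ℤ-Solver.solve-∀

conj-+σ : ∀ x y → conj (x +σ y) ≡ conj x +σ conj y
conj-+σ (mk a b) (mk c d) = mk-cong (re-+ a b c d) (ℤ.neg-distrib-+ b d)
  where
  re-+ : ∀ a b c d → (a ℤ.+ c) ℤ.+ (b ℤ.+ d) ≡ (a ℤ.+ b) ℤ.+ (c ℤ.+ d)
  re-+ = ℤ-Solver.solve-∀

conj-*σ : ∀ x y → conj (x *σ y) ≡ conj x *σ conj y
conj-*σ (mk a b) (mk c d) = mk-cong (re-* a b c d) (im-* a b c d)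
  where
  re-* : ∀ a b c d →
    (a ℤ.* c ℤ.- b ℤ.* d) ℤ.+ (a ℤ.* d ℤ.+ b ℤ.* c ℤ.+ b ℤ.* d) ≡
    (a ℤ.+ b) ℤ.* (c ℤ.+ d) ℤ.- (ℤ.- b) ℤ.* (ℤ.- d)
  re-* = ℤ-Solver.solve-∀
  im-* : ∀ a b c d →
    ℤ.- (a ℤ.* d ℤ.+ b ℤ.* c ℤ.+ b ℤ.* d) ≡
    (a ℤ.+ b) ℤ.* (ℤ.- d) ℤ.+ (ℤ.- b) ℤ.* (c ℤ.+ d) ℤ.+ (ℤ.- b) ℤ.* (ℤ.- d)
  im-* = ℤ-Solver.solve-∀

conj-neg : ∀ x → conj (-σ x) ≡ -σ conj x
conj-neg (mk a b) = mk-cong (sym (ℤ.neg-distrib-+ a b)) refl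

conj-involutive : ∀ x → conj (conj x) ≡ x
conj-involutive (mk a b) = mk-cong (re-conj a b) (ℤ.neg-involutive b)
  where
  re-conj : ∀ a b → (a ℤ.+ b) ℤ.+ ℤ.- b ≡ a
  re-conj = ℤ-Solver.solve-∀

conj-sub-mul : ∀ x u y → conj (x -σ u *σ y) ≡ conj x -σ conj u *σ conj y
conj-sub-mul x u y = begin
  conj (x -σ u *σ y)                ≡⟨ conj-+σ x (-σ (u *σ y)) ⟩
  conj x +σ conj (-σ (u *σ y))      ≡⟨ cong (conj x +σ_) (conj-neg (u *σ y)) ⟩
  conj x -σ conj (u *σ y)           ≡⟨ cong (λ v → conj x -σ v) (conj-*σ u y) ⟩
  conj x -σ conj u *σ conj y        ∎

conj-nonzero : ∀ {x} → x ≢ 0σ → conj x ≢ 0σ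
conj-nonzero {x} x≢0 x̄≡0 = x≢0 (trans (sym (conj-involutive x)) (cong conj x̄≡0))

*σ-conj : ∀ x → x *σ conj x ≡ fromℤ (norm x)
*σ-conj (mk a b) = mk-cong (re-norm a b) (im-norm a b)
  where
  re-norm : ∀ a b → a ℤ.* (a ℤ.+ b) ℤ.- b ℤ.* ℤ.- b ≡ a ℤ.* a ℤ.+ a ℤ.* b ℤ.+ b ℤ.* b
  re-norm = ℤ-Solver.solve-∀
  im-norm : ∀ a b → a ℤ.* ℤ.- b ℤ.+ b ℤ.* (a ℤ.+ b) ℤ.+ b ℤ.* ℤ.- b ≡ + 0
  im-norm = ℤ-Solver.solve-∀

trace : ℤσ → ℤ
trace (mk a b) = a ℤ.+ (a ℤ.+ b)

+σ-conj : ∀ x → x +σ conj x ≡ fromℤ (trace x)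
+σ-conj (mk a b) = mk-cong refl (ℤ.+-inverseʳ b)

fromℤ-trace : ∀ c z → fromℤ (trace (conj c *σ z)) ≡ conj c *σ z +σ c *σ conj z
fromℤ-trace c z = begin
  fromℤ (trace (conj c *σ z))                 ≡⟨ +σ-conj (conj c *σ z) ⟨
  conj c *σ z +σ conj (conj c *σ z)           ≡⟨ cong (conj c *σ z +σ_) (conj-*σ (conj c) z) ⟩
  conj c *σ z +σ conj (conj c) *σ conj z      ≡⟨ cong (λ v → conj c *σ z +σ v *σ conj z) (conj-involutive c) ⟩
  conj c *σ z +σ c *σ conj z                  ∎

norm-*σ : ∀ x y → norm (x *σ y) ≡ norm x ℤ.* norm y
norm-*σ x y = fromℤ-injective (begin
  fromℤ (norm (x *σ y))                 ≡⟨ *σ-conj (x *σ y) ⟨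
  (x *σ y) *σ conj (x *σ y)             ≡⟨ cong ((x *σ y) *σ_) (conj-*σ x y) ⟩
  (x *σ y) *σ (conj x *σ conj y)        ≡⟨ interchange x y (conj x) (conj y) ⟩
  (x *σ conj x) *σ (y *σ conj y)        ≡⟨ cong₂ _*σ_ (*σ-conj x) (*σ-conj y) ⟩
  fromℤ (norm x) *σ fromℤ (norm y)      ≡⟨ fromℤ-* (norm x) (norm y) ⟨
  fromℤ (norm x ℤ.* norm y)             ∎)
  where
  interchange : ∀ a b c d → (a *σ b) *σ (c *σ d) ≡ (a *σ c) *σ (b *σ d)
  interchange = solve-∀ ℤσ-ring

norm-conj : ∀ x → norm (conj x) ≡ norm x
norm-conj x = fromℤ-injective (begin
  fromℤ (norm (conj x))       ≡⟨ *σ-conj (conj x) ⟨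
  conj x *σ conj (conj x)     ≡⟨ cong (conj x *σ_) (conj-involutive x) ⟩
  conj x *σ x                 ≡⟨ *σ-comm (conj x) x ⟩
  x *σ conj x                 ≡⟨ *σ-conj x ⟩
  fromℤ (norm x)              ∎)

norm-neg : ∀ x → norm (-σ x) ≡ norm x
norm-neg x = begin
  norm (-σ x)                 ≡⟨ cong norm (neg-as-product x) ⟩
  norm ((-σ 1σ) *σ x)         ≡⟨ norm-*σ (-σ 1σ) x ⟩
  + 1 ℤ.* norm x              ≡⟨ ℤ.*-identityˡ (norm x) ⟩
  norm x                      ∎
  where
  neg-as-product : ∀ a → -σ a ≡ (-σ 1σ) *σ a
  neg-as-product = solve-∀ ℤσ-ring

normℕ : ℤσ → ℕ
normℕ x = ∣ norm x ∣

normℕ-*σ-conj : ∀ x y → normℕ (x *σ conj y) ≡ normℕ x * normℕ y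
normℕ-*σ-conj x y = begin
  ∣ norm (x *σ conj y) ∣                ≡⟨ cong ∣_∣ (norm-*σ x (conj y)) ⟩
  ∣ norm x ℤ.* norm (conj y) ∣          ≡⟨ cong (λ v → ∣ norm x ℤ.* v ∣) (norm-conj y) ⟩
  ∣ norm x ℤ.* norm y ∣                 ≡⟨ ℤ.abs-* (norm x) (norm y) ⟩
  normℕ x * normℕ y                     ∎

square≡+∣∣² : ∀ i → i ℤ.* i ≡ + (∣ i ∣ * ∣ i ∣)
square≡+∣∣² (+ ℕ.zero)  = refl
square≡+∣∣² (+ ℕ.suc n) = refl
square≡+∣∣² -[1+ n ]    = refl

twice-norm : ∀ a b →
  + 2 ℤ.* norm (mk a b) ≡ + (∣ a ∣ * ∣ a ∣ + ∣ b ∣ * ∣ b ∣ + ∣ a ℤ.+ b ∣ * ∣ a ℤ.+ b ∣)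
twice-norm a b = begin
  + 2 ℤ.* norm (mk a b)                              ≡⟨ sum-of-squares a b ⟩
  a ℤ.* a ℤ.+ b ℤ.* b ℤ.+ (a ℤ.+ b) ℤ.* (a ℤ.+ b)
    ≡⟨ cong₂ ℤ._+_ (cong₂ ℤ._+_ (square≡+∣∣² a) (square≡+∣∣² b)) (square≡+∣∣² (a ℤ.+ b)) ⟩
  + (∣ a ∣ * ∣ a ∣ + ∣ b ∣ * ∣ b ∣ + ∣ a ℤ.+ b ∣ * ∣ a ℤ.+ b ∣) ∎
  where
  sum-of-squares : ∀ a b →
    + 2 ℤ.* (a ℤ.* a ℤ.+ a ℤ.* b ℤ.+ b ℤ.* b) ≡ a ℤ.* a ℤ.+ b ℤ.* b ℤ.+ (a ℤ.+ b) ℤ.* (a ℤ.+ b)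
  sum-of-squares = ℤ-Solver.solve-∀

norm≡+normℕ : ∀ x → norm x ≡ + normℕ x
norm≡+normℕ (mk a b) = nonneg-half (norm (mk a b)) (twice-norm a b)
  where
  nonneg-half : ∀ i {k} → + 2 ℤ.* i ≡ + k → i ≡ + ∣ i ∣
  nonneg-half (+ _)     _ = refl
  nonneg-half -[1+ _ ] ()

norm≡0⇒≡0σ : ∀ x → norm x ≡ + 0 → x ≡ 0σ
norm≡0⇒≡0σ (mk a b) N≡0 = mk-cong (square≡0⇒≡0 a a²≡0) (square≡0⇒≡0 b b²≡0)
  where
  squares≡0 : ∣ a ∣ * ∣ a ∣ + ∣ b ∣ * ∣ b ∣ + ∣ a ℤ.+ b ∣ * ∣ a ℤ.+ b ∣ ≡ 0
  squares≡0 = ℤ.+-injective (trans (sym (twice-norm a b)) (cong (+ 2 ℤ.*_) N≡0))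
  a²≡0 : ∣ a ∣ * ∣ a ∣ ≡ 0
  a²≡0 = ℕ.m+n≡0⇒m≡0 _ (ℕ.m+n≡0⇒m≡0 _ squares≡0)
  b²≡0 : ∣ b ∣ * ∣ b ∣ ≡ 0
  b²≡0 = ℕ.m+n≡0⇒n≡0 (∣ a ∣ * ∣ a ∣) (ℕ.m+n≡0⇒m≡0 _ squares≡0)
  square≡0⇒≡0 : ∀ i → ∣ i ∣ * ∣ i ∣ ≡ 0 → i ≡ + 0
  square≡0⇒≡0 i i²≡0 with ℕ.m*n≡0⇒m≡0∨n≡0 ∣ i ∣ i²≡0
  ... | inj₁ ∣i∣≡0 = ℤ.∣i∣≡0⇒i≡0 ∣i∣≡0
  ... | inj₂ ∣i∣≡0 = ℤ.∣i∣≡0⇒i≡0 ∣i∣≡0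

normℕ>0 : ∀ {x} → x ≢ 0σ → 1 ≤ normℕ x
normℕ>0 {x} x≢0 = ℕ.n≢0⇒n>0 λ Nx≡0 → x≢0 (norm≡0⇒≡0σ x (trans (norm≡+normℕ x) (cong +_ Nx≡0)))

*σ-zero-product : ∀ x y → x *σ y ≡ 0σ → x ≡ 0σ ⊎ y ≡ 0σ
*σ-zero-product x y xy≡0 =
  Sum.map (norm≡0⇒≡0σ x) (norm≡0⇒≡0σ y) (ℤ.i*j≡0⇒i≡0∨j≡0 (norm x) {norm y} Nx*Ny≡0)
  where
  Nx*Ny≡0 : norm x ℤ.* norm y ≡ + 0
  Nx*Ny≡0 = trans (sym (norm-*σ x y)) (cong norm xy≡0)

*σ-nonzero : ∀ {x y} → x ≢ 0σ → y ≢ 0σ → x *σ y ≢ 0σ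
*σ-nonzero {x} {y} x≢0 y≢0 xy≡0 = Sum.[ x≢0 , y≢0 ] (*σ-zero-product x y xy≡0)

norm≡1⇒nonzero : ∀ u → norm u ≡ + 1 → u ≢ 0σ
norm≡1⇒nonzero u N≡1 u≡0 = contradiction (trans (sym (cong norm u≡0)) N≡1) λ ()

-- Units and division with unit quotients

-- unit k = σ ^ k
unit : Fin 6 → ℤσ
unit zero                               = mk (+ 1) (+ 0)
unit (suc zero)                         = mk (+ 0) (+ 1)
unit (suc (suc zero))                   = mk -[1+ 0 ] (+ 1)
unit (suc (suc (suc zero)))             = mk -[1+ 0 ] (+ 0)
unit (suc (suc (suc (suc zero))))       = mk (+ 0) -[1+ 0 ]
unit (suc (suc (suc (suc (suc zero))))) = mk (+ 1) -[1+ 0 ]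

norm-unit : ∀ k → norm (unit k) ≡ + 1
norm-unit zero                               = refl
norm-unit (suc zero)                         = refl
norm-unit (suc (suc zero))                   = refl
norm-unit (suc (suc (suc zero)))             = refl
norm-unit (suc (suc (suc (suc zero))))       = refl
norm-unit (suc (suc (suc (suc (suc zero))))) = refl

norm≡1⇒unit : ∀ u → norm u ≡ + 1 → Σ (Fin 6) λ k → u ≡ unit k
norm≡1⇒unit (mk a b) N≡1 = classify (small a a²≤2) (small b b²≤2) N≡1
  where
  squares≡2 : ∣ a ∣ * ∣ a ∣ + ∣ b ∣ * ∣ b ∣ + ∣ a ℤ.+ b ∣ * ∣ a ℤ.+ b ∣ ≡ 2
  squares≡2 = ℤ.+-injective (trans (sym (twice-norm a b)) (cong (+ 2 ℤ.*_) N≡1))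
  a²≤2 : ∣ a ∣ * ∣ a ∣ ≤ 2
  a²≤2 = ℕ.m+n≤o⇒m≤o _ (ℕ.m+n≤o⇒m≤o _ (ℕ.≤-reflexive squares≡2))
  b²≤2 : ∣ b ∣ * ∣ b ∣ ≤ 2
  b²≤2 = ℕ.m+n≤o⇒n≤o (∣ a ∣ * ∣ a ∣) (ℕ.m+n≤o⇒m≤o _ (ℕ.≤-reflexive squares≡2))
  Small : ℤ → Set
  Small i = i ≡ + 0 ⊎ i ≡ + 1 ⊎ i ≡ -[1+ 0 ]
  two≤⇒big : ∀ n → ¬ (ℕ.suc (ℕ.suc n) * ℕ.suc (ℕ.suc n) ≤ 2)
  two≤⇒big n ≤2 with ℕ.≤-trans (ℕ.*-mono-≤ {2} {ℕ.suc (ℕ.suc n)} (s≤s (s≤s z≤n)) (s≤s (s≤s z≤n))) ≤2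
  ... | s≤s (s≤s ())
  small : ∀ i → ∣ i ∣ * ∣ i ∣ ≤ 2 → Small i
  small (+ 0)                     _  = inj₁ refl
  small (+ 1)                     _  = inj₂ (inj₁ refl)
  small (+ ℕ.suc (ℕ.suc n))       ≤2 = ⊥-elim (two≤⇒big n ≤2)
  small -[1+ 0 ]                  _  = inj₂ (inj₂ refl)
  small -[1+ ℕ.suc n ]            ≤2 = ⊥-elim (two≤⇒big n ≤2)
  classify : Small a → Small b → norm (mk a b) ≡ + 1 → Σ (Fin 6) λ k → mk a b ≡ unit k
  classify (inj₁ refl)        (inj₁ refl)        ()
  classify (inj₁ refl)        (inj₂ (inj₁ refl)) _  = suc zero , refl
  classify (inj₁ refl)        (inj₂ (inj₂ refl)) _  = suc (suc (suc (suc zero))) , refl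
  classify (inj₂ (inj₁ refl)) (inj₁ refl)        _  = zero , refl
  classify (inj₂ (inj₁ refl)) (inj₂ (inj₁ refl)) ()
  classify (inj₂ (inj₁ refl)) (inj₂ (inj₂ refl)) _  = suc (suc (suc (suc (suc zero)))) , refl
  classify (inj₂ (inj₂ refl)) (inj₁ refl)        _  = suc (suc (suc zero)) , refl
  classify (inj₂ (inj₂ refl)) (inj₂ (inj₁ refl)) _  = suc (suc zero) , refl
  classify (inj₂ (inj₂ refl)) (inj₂ (inj₂ refl)) ()

norm-sub : ∀ x u y →
  norm (x -σ u *σ y) ℤ.+ trace (conj u *σ (x *σ conj y)) ≡ norm x ℤ.+ norm u ℤ.* norm y
norm-sub x u y = fromℤ-injective (begin
  fromℤ (norm (x -σ u *σ y)) +σ fromℤ (trace (conj u *σ (x *σ conj y)))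
    ≡⟨ cong₂ _+σ_ (sym (*σ-conj (x -σ u *σ y))) (fromℤ-trace u (x *σ conj y)) ⟩
  (x -σ u *σ y) *σ conj (x -σ u *σ y) +σ (conj u *σ (x *σ conj y) +σ u *σ conj (x *σ conj y))
    ≡⟨ cong₂ (λ v w → (x -σ u *σ y) *σ v +σ (conj u *σ (x *σ conj y) +σ u *σ w))
             (conj-sub-mul x u y) (trans (conj-*σ x (conj y)) (cong (conj x *σ_) (conj-involutive y))) ⟩
  (x -σ u *σ y) *σ (conj x -σ conj u *σ conj y) +σ (conj u *σ (x *σ conj y) +σ u *σ (conj x *σ y))
    ≡⟨ expand x (conj x) u (conj u) y (conj y) ⟩
  x *σ conj x +σ (u *σ conj u) *σ (y *σ conj y)
    ≡⟨ cong₂ (λ v w → v +σ w) (*σ-conj x) (cong₂ _*σ_ (*σ-conj u) (*σ-conj y)) ⟩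
  fromℤ (norm x) +σ fromℤ (norm u) *σ fromℤ (norm y)
    ≡⟨ cong (fromℤ (norm x) +σ_) (fromℤ-* (norm u) (norm y)) ⟨
  fromℤ (norm x ℤ.+ norm u ℤ.* norm y) ∎)
  where
  expand : ∀ x x′ u u′ y y′ →
    (x -σ u *σ y) *σ (x′ -σ u′ *σ y′) +σ (u′ *σ (x *σ y′) +σ u *σ (x′ *σ y)) ≡
    x *σ x′ +σ (u *σ u′) *σ (y *σ y′)
  expand = solve-∀ ℤσ-ring

-- unitTrace k z = 2 Re(ū z) for u = unit k
unitTrace : Fin 6 → ℤσ → ℤ
unitTrace k z = trace (conj (unit k) *σ z)

unitTrace-squares : ∀ z →
  unitTrace zero z ℤ.* unitTrace zero z ℤ.+ unitTrace (suc zero) z ℤ.* unitTrace (suc zero) z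
    ℤ.+ unitTrace (suc (suc zero)) z ℤ.* unitTrace (suc (suc zero)) z ≡ + 6 ℤ.* norm z
unitTrace-squares z = fromℤ-injective (begin
  fromℤ (t₀ ℤ.* t₀ ℤ.+ t₁ ℤ.* t₁ ℤ.+ t₂ ℤ.* t₂)
    ≡⟨ cong₂ _+σ_ (cong₂ _+σ_ (fromℤ-* t₀ t₀) (fromℤ-* t₁ t₁)) (fromℤ-* t₂ t₂) ⟩
  fromℤ t₀ *σ fromℤ t₀ +σ fromℤ t₁ *σ fromℤ t₁ +σ fromℤ t₂ *σ fromℤ t₂
    ≡⟨ cong₂ _+σ_ (cong₂ _+σ_ (square (fromℤ-trace u₀ z)) (square (fromℤ-trace u₁ z)))
                  (square (fromℤ-trace u₂ z)) ⟩
  (conj u₀ *σ z +σ u₀ *σ conj z) *σ (conj u₀ *σ z +σ u₀ *σ conj z)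
    +σ (conj u₁ *σ z +σ u₁ *σ conj z) *σ (conj u₁ *σ z +σ u₁ *σ conj z)
    +σ (conj u₂ *σ z +σ u₂ *σ conj z) *σ (conj u₂ *σ z +σ u₂ *σ conj z)
    ≡⟨ cube-roots-cancel z (conj z) ⟩
  fromℤ (+ 6) *σ (z *σ conj z)
    ≡⟨ cong (fromℤ (+ 6) *σ_) (*σ-conj z) ⟩
  fromℤ (+ 6) *σ fromℤ (norm z)
    ≡⟨ fromℤ-* (+ 6) (norm z) ⟨
  fromℤ (+ 6 ℤ.* norm z) ∎)
  where
  u₀ u₁ u₂ : ℤσ
  u₀ = unit zero
  u₁ = unit (suc zero)
  u₂ = unit (suc (suc zero))
  t₀ t₁ t₂ : ℤ
  t₀ = unitTrace zero z
  t₁ = unitTrace (suc zero) z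
  t₂ = unitTrace (suc (suc zero)) z
  square : ∀ {a b} → a ≡ b → a *σ a ≡ b *σ b
  square a≡b = cong₂ _*σ_ a≡b a≡b
  -- 1 + σ² + σ⁴ = 0 kills the z² and z′² terms.
  cube-roots-cancel : ∀ z z′ →
    (conj u₀ *σ z +σ u₀ *σ z′) *σ (conj u₀ *σ z +σ u₀ *σ z′)
      +σ (conj u₁ *σ z +σ u₁ *σ z′) *σ (conj u₁ *σ z +σ u₁ *σ z′)
      +σ (conj u₂ *σ z +σ u₂ *σ z′) *σ (conj u₂ *σ z +σ u₂ *σ z′)
    ≡ fromℤ (+ 6) *σ (z *σ z′)
  cube-roots-cancel = solve-∀ ℤσ-ring

unitTrace-squaresℕ : ∀ z →
  ∣ unitTrace zero z ∣ * ∣ unitTrace zero z ∣ + ∣ unitTrace (suc zero) z ∣ * ∣ unitTrace (suc zero) z ∣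
    + ∣ unitTrace (suc (suc zero)) z ∣ * ∣ unitTrace (suc (suc zero)) z ∣ ≡ 6 * normℕ z
unitTrace-squaresℕ z = ℤ.+-injective (begin
  + (∣ t₀ ∣ * ∣ t₀ ∣ + ∣ t₁ ∣ * ∣ t₁ ∣ + ∣ t₂ ∣ * ∣ t₂ ∣)
    ≡⟨ cong₂ ℤ._+_ (cong₂ ℤ._+_ (square≡+∣∣² t₀) (square≡+∣∣² t₁)) (square≡+∣∣² t₂) ⟨
  t₀ ℤ.* t₀ ℤ.+ t₁ ℤ.* t₁ ℤ.+ t₂ ℤ.* t₂     ≡⟨ unitTrace-squares z ⟩
  + 6 ℤ.* norm z                            ≡⟨ cong (+ 6 ℤ.*_) (norm≡+normℕ z) ⟩
  + 6 ℤ.* + normℕ z                         ≡⟨ ℤ.pos-* 6 (normℕ z) ⟨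
  + (6 * normℕ z)                           ∎)
  where
  t₀ t₁ t₂ : ℤ
  t₀ = unitTrace zero z
  t₁ = unitTrace (suc zero) z
  t₂ = unitTrace (suc (suc zero)) z

unitTrace-opposite : ∀ k k′ z → unit k′ ≡ -σ unit k → unitTrace k′ z ≡ ℤ.- unitTrace k z
unitTrace-opposite k k′ z u′≡-u = begin
  trace (conj (unit k′) *σ z)       ≡⟨ cong (λ v → trace (conj v *σ z)) u′≡-u ⟩
  trace (conj (-σ unit k) *σ z)     ≡⟨ cong (λ v → trace (v *σ z)) (conj-neg (unit k)) ⟩
  trace ((-σ conj (unit k)) *σ z)   ≡⟨ cong trace (neg-*σ (conj (unit k)) z) ⟩
  trace (-σ (conj (unit k) *σ z))   ≡⟨ trace-neg (conj (unit k) *σ z) ⟩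
  ℤ.- trace (conj (unit k) *σ z)    ∎
  where
  neg-*σ : ∀ a b → (-σ a) *σ b ≡ -σ (a *σ b)
  neg-*σ = solve-∀ ℤσ-ring
  trace-neg : ∀ w → trace (-σ w) ≡ ℤ.- trace w
  trace-neg (mk a b) = neg-sum a b
    where
    neg-sum : ∀ a b → ℤ.- a ℤ.+ (ℤ.- a ℤ.+ ℤ.- b) ≡ ℤ.- (a ℤ.+ (a ℤ.+ b))
    neg-sum = ℤ-Solver.solve-∀

normℕ-sub-unit : ∀ k x y {A} → unitTrace k (x *σ conj y) ≡ + A →
  normℕ (x -σ unit k *σ y) + A ≡ normℕ x + normℕ y
normℕ-sub-unit k x y {A} t≡A = ℤ.+-injective (begin
  + (normℕ (x -σ unit k *σ y) + A)                      ≡⟨ cong₂ ℤ._+_ (norm≡+normℕ (x -σ unit k *σ y)) t≡A ⟨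
  norm (x -σ unit k *σ y) ℤ.+ unitTrace k (x *σ conj y) ≡⟨ norm-sub x (unit k) y ⟩
  norm x ℤ.+ norm (unit k) ℤ.* norm y                   ≡⟨ cong (λ v → norm x ℤ.+ v ℤ.* norm y) (norm-unit k) ⟩
  norm x ℤ.+ + 1 ℤ.* norm y                             ≡⟨ cong (λ v → norm x ℤ.+ v) (ℤ.*-identityˡ (norm y)) ⟩
  norm x ℤ.+ norm y                                     ≡⟨ cong₂ ℤ._+_ (norm≡+normℕ x) (norm≡+normℕ y) ⟩
  + (normℕ x + normℕ y)                                 ∎)

-- The squares of the traces 2 Re(ū x ȳ) for u = 1, σ, σ² add up to 6 N x N y ≥ 6 (N y)², so one
-- of them exceeds N y in absolute value, and the corresponding unit ±u reduces N x.
euclidean-step : ∀ x y → y ≢ 0σ → normℕ y ≤ normℕ x →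
  Σ (Fin 6) λ k → normℕ (x -σ unit k *σ y) < normℕ x
euclidean-step x y y≢0 n≤m = choose (∣ t₀ ∣ ℕ.≤? n) (∣ t₁ ∣ ℕ.≤? n) (∣ t₂ ∣ ℕ.≤? n)
  where
  z : ℤσ
  z = x *σ conj y
  m n : ℕ
  m = normℕ x
  n = normℕ y
  k₀ k₁ k₂ k₃ k₄ k₅ : Fin 6
  k₀ = zero
  k₁ = suc zero
  k₂ = suc (suc zero)
  k₃ = suc (suc (suc zero))
  k₄ = suc (suc (suc (suc zero)))
  k₅ = suc (suc (suc (suc (suc zero))))
  t₀ t₁ t₂ : ℤ
  t₀ = unitTrace k₀ z
  t₁ = unitTrace k₁ z
  t₂ = unitTrace k₂ z

  reduces : ∀ k {A} → unitTrace k z ≡ + A → n < A → normℕ (x -σ unit k *σ y) < m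
  reduces k t≡A n<A = ℕ.≰⇒> λ m≤N → ℕ.<-irrefl (sym (normℕ-sub-unit k x y t≡A)) (ℕ.+-mono-≤-< m≤N n<A)

  large : ∀ k k′ → unitTrace k′ z ≡ ℤ.- unitTrace k z → n < ∣ unitTrace k z ∣ →
          Σ (Fin 6) λ k → normℕ (x -σ unit k *σ y) < m
  large k k′ t′≡-t n<∣t∣ =
    Sum.[ (λ t≡∣t∣ → k , reduces k t≡∣t∣ n<∣t∣)
        , (λ -t≡∣t∣ → k′ , reduces k′ (trans t′≡-t -t≡∣t∣) n<∣t∣) ]
        (sign-cases (unitTrace k z))
    where
    sign-cases : ∀ i → i ≡ + ∣ i ∣ ⊎ ℤ.- i ≡ + ∣ i ∣
    sign-cases (+ _)    = inj₁ refl
    sign-cases -[1+ _ ] = inj₂ refl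

  not-all-small : ∣ t₀ ∣ ≤ n → ∣ t₁ ∣ ≤ n → ∣ t₂ ∣ ≤ n → ⊥
  not-all-small s₀ s₁ s₂ =
    ℕ.<-irrefl (unitTrace-squaresℕ z) (ℕ.≤-<-trans small-squares (ℕ.<-≤-trans three<six six≤))
    where
    small-squares : ∣ t₀ ∣ * ∣ t₀ ∣ + ∣ t₁ ∣ * ∣ t₁ ∣ + ∣ t₂ ∣ * ∣ t₂ ∣ ≤ n * n + n * n + n * n
    small-squares = ℕ.+-mono-≤ (ℕ.+-mono-≤ (ℕ.*-mono-≤ s₀ s₀) (ℕ.*-mono-≤ s₁ s₁)) (ℕ.*-mono-≤ s₂ s₂)
    three-pos : 0 < n * n + n * n + n * n
    three-pos = ℕ.<-≤-trans (ℕ.*-mono-≤ (normℕ>0 y≢0) (normℕ>0 y≢0))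
                            (ℕ.≤-trans (ℕ.m≤m+n (n * n) (n * n)) (ℕ.m≤m+n (n * n + n * n) (n * n)))
    three<six : n * n + n * n + n * n < 6 * (n * n)
    three<six = subst (n * n + n * n + n * n <_) (three+three≡six (n * n)) (ℕ.m<m+n (n * n + n * n + n * n) three-pos)
      where
      three+three≡six : ∀ k → k + k + k + (k + k + k) ≡ 6 * k
      three+three≡six = ℕ-Solver.solve-∀
    six≤ : 6 * (n * n) ≤ 6 * normℕ z
    six≤ = ℕ.*-monoʳ-≤ 6 (subst (n * n ≤_) (sym (normℕ-*σ-conj x y)) (ℕ.*-monoˡ-≤ n n≤m))

  choose : Dec (∣ t₀ ∣ ≤ n) → Dec (∣ t₁ ∣ ≤ n) → Dec (∣ t₂ ∣ ≤ n) →
           Σ (Fin 6) λ k → normℕ (x -σ unit k *σ y) < m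
  choose (no t₀-large) _             _             = large k₀ k₃ (unitTrace-opposite k₀ k₃ z refl) (ℕ.≰⇒> t₀-large)
  choose (yes _)       (no t₁-large) _             = large k₁ k₄ (unitTrace-opposite k₁ k₄ z refl) (ℕ.≰⇒> t₁-large)
  choose (yes _)       (yes _)       (no t₂-large) = large k₂ k₅ (unitTrace-opposite k₂ k₅ z refl) (ℕ.≰⇒> t₂-large)
  choose (yes s₀)      (yes s₁)      (yes s₂)      = ⊥-elim (not-all-small s₀ s₁ s₂)

infixr 7 _·P_
infixl 6 _+P_

_·P_ : ℤσ → Pair → Pair
c ·P (p , q) = (c *σ p , c *σ q)

_+P_ : Pair → Pair → Pair
(p , q) +P (r , s) = (p +σ r , q +σ s)

-P_ : Pair → Pair
-P (p , q) = (-σ p , -σ q)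

conjP : Pair → Pair
conjP (p , q) = (conj p , conj q)

cross : Pair → Pair → ℤσ
cross (p , q) (r , s) = p *σ s -σ q *σ r

·P-identity : ∀ x → 1σ ·P x ≡ x
·P-identity (p , q) = cong₂ _,_ (*σ-identityˡ p) (*σ-identityˡ q)

·P-assoc : ∀ c d x → c ·P (d ·P x) ≡ (c *σ d) ·P x
·P-assoc c d (p , q) = cong₂ _,_ (sym (*σ-assoc c d p)) (sym (*σ-assoc c d q))

conjP-·P : ∀ c x → conjP (c ·P x) ≡ conj c ·P conjP x
conjP-·P c (p , q) = cong₂ _,_ (conj-*σ c p) (conj-*σ c q)

conjP-involutive : ∀ x → conjP (conjP x) ≡ x
conjP-involutive (p , q) = cong₂ _,_ (conj-involutive p) (conj-involutive q)

-- Unlike _≈P_, which relates (0 , 0) to every pair, this relation is transitive.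
infix 4 _∼_
record _∼_ (x y : Pair) : Set where
  constructor proportional
  field
    c d    : ℤσ
    c≢0    : c ≢ 0σ
    d≢0    : d ≢ 0σ
    cx≡dy  : c ·P x ≡ d ·P y

∼-reflexive : ∀ {x y} → x ≡ y → x ∼ y
∼-reflexive x≡y = proportional 1σ 1σ (λ ()) (λ ()) (cong (1σ ·P_) x≡y)

∼-by : ∀ {x y} c → c ≢ 0σ → x ≡ c ·P y → x ∼ y
∼-by {x} c c≢0 x≡cy = proportional 1σ c (λ ()) c≢0 (trans (·P-identity x) x≡cy)

∼-sym : ∀ {x y} → x ∼ y → y ∼ x
∼-sym (proportional c d c≢0 d≢0 cx≡dy) = proportional d c d≢0 c≢0 (sym cx≡dy)

∼-trans : ∀ {x y z} → x ∼ y → y ∼ z → x ∼ z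
∼-trans {x} {y} {z} (proportional c d c≢0 d≢0 cx≡dy) (proportional c′ d′ c′≢0 d′≢0 c′y≡d′z) =
  proportional (c′ *σ c) (d *σ d′) (*σ-nonzero c′≢0 c≢0) (*σ-nonzero d≢0 d′≢0) (begin
    (c′ *σ c) ·P x      ≡⟨ ·P-assoc c′ c x ⟨
    c′ ·P (c ·P x)      ≡⟨ cong (c′ ·P_) cx≡dy ⟩
    c′ ·P (d ·P y)      ≡⟨ ·P-assoc c′ d y ⟩
    (c′ *σ d) ·P y      ≡⟨ cong (_·P y) (*σ-comm c′ d) ⟩
    (d *σ c′) ·P y      ≡⟨ ·P-assoc d c′ y ⟨
    d ·P (c′ ·P y)      ≡⟨ cong (d ·P_) c′y≡d′z ⟩
    d ·P (d′ ·P z)      ≡⟨ ·P-assoc d d′ z ⟩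
    (d *σ d′) ·P z      ∎)

Projective : (Pair → Pair) → Set
Projective f = ∀ {x y} → x ∼ y → f x ∼ f y

semilinear⇒projective : ∀ {f} (φ : ℤσ → ℤσ) → (∀ {c} → c ≢ 0σ → φ c ≢ 0σ) →
  (∀ c x → f (c ·P x) ≡ φ c ·P f x) → Projective f
semilinear⇒projective {f} φ φ-nonzero f-semilinear {x} {y} (proportional c d c≢0 d≢0 cx≡dy) =
  proportional (φ c) (φ d) (φ-nonzero c≢0) (φ-nonzero d≢0)
    (trans (sym (f-semilinear c x)) (trans (cong f cx≡dy) (f-semilinear d y)))

conjP-projective : Projective conjP
conjP-projective = semilinear⇒projective conj conj-nonzero conjP-·P

pointwise-∼⇒projective : ∀ {f g : Pair → Pair} → (∀ x → f x ∼ g x) → Projective g → Projective f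
pointwise-∼⇒projective f∼g g-projective x∼y = ∼-trans (f∼g _) (∼-trans (g-projective x∼y) (∼-sym (f∼g _)))

≈P-sym : ∀ x y → x ≈P y → y ≈P x
≈P-sym (p , q) (p′ , q′) pq′≡qp′ = trans (*σ-comm p′ q) (trans (sym pq′≡qp′) (*σ-comm p q′))

cross-·Pʳ : ∀ x c y → cross x (c ·P y) ≡ c *σ cross x y
cross-·Pʳ (p , q) c (r , s) = pull-scalar p q c r s
  where
  pull-scalar : ∀ p q c r s → p *σ (c *σ s) -σ q *σ (c *σ r) ≡ c *σ (p *σ s -σ q *σ r)
  pull-scalar = solve-∀ ℤσ-ring

≈P⇔cross≡0 : ∀ x y → (x ≈P y → cross x y ≡ 0σ) × (cross x y ≡ 0σ → x ≈P y)
≈P⇔cross≡0 (p , q) (r , s) =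
  (λ ps≡qr → trans (cong (λ v → v -σ q *σ r) ps≡qr) (sub-self (q *σ r))) , sub≡0⇒≡ (p *σ s) (q *σ r)
  where
  sub-self : ∀ a → a -σ a ≡ 0σ
  sub-self = solve-∀ ℤσ-ring
  sub≡0⇒≡ : ∀ a b → a -σ b ≡ 0σ → a ≡ b
  sub≡0⇒≡ a b a-b≡0 = begin
    a                 ≡⟨ sub-add a b ⟩
    (a -σ b) +σ b     ≡⟨ cong (_+σ b) a-b≡0 ⟩
    0σ +σ b           ≡⟨ zero-add b ⟩
    b                 ∎
    where
    sub-add : ∀ a b → a ≡ (a -σ b) +σ b
    sub-add = solve-∀ ℤσ-ring
    zero-add : ∀ b → 0σ +σ b ≡ b
    zero-add = solve-∀ ℤσ-ring

≈P-respʳ-∼ : ∀ a {x y} → a ≈P x → x ∼ y → a ≈P y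
≈P-respʳ-∼ a {x} {y} a≈x (proportional c d c≢0 d≢0 cx≡dy) =
  Sum.[ ⊥-elim ∘ d≢0 , proj₂ (≈P⇔cross≡0 a y) ] (*σ-zero-product d (cross a y) d·cross≡0)
  where
  d·cross≡0 : d *σ cross a y ≡ 0σ
  d·cross≡0 = begin
    d *σ cross a y      ≡⟨ cross-·Pʳ a d y ⟨
    cross a (d ·P y)    ≡⟨ cong (cross a) cx≡dy ⟨
    cross a (c ·P x)    ≡⟨ cross-·Pʳ a c x ⟩
    c *σ cross a x      ≡⟨ cong (c *σ_) (proj₁ (≈P⇔cross≡0 a x) a≈x) ⟩
    c *σ 0σ             ≡⟨ mul-zero c ⟩
    0σ                  ∎
    where
    mul-zero : ∀ c → c *σ 0σ ≡ 0σ
    mul-zero = solve-∀ ℤσ-ring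

≈P-respˡ-∼ : ∀ a {x y} → x ≈P a → x ∼ y → y ≈P a
≈P-respˡ-∼ a {x} {y} x≈a x∼y = ≈P-sym a y (≈P-respʳ-∼ a (≈P-sym x a x≈a) x∼y)

infix 4 _⊆∼_ _≋_

_⊆∼_ : List Pair → List Pair → Set
xs ⊆∼ ys = All (λ x → Any (x ∼_) ys) xs

_≋_ : List Pair → List Pair → Set
xs ≋ ys = xs ⊆∼ ys × ys ⊆∼ xs

⊆∼-trans : ∀ {xs ys zs} → xs ⊆∼ ys → ys ⊆∼ zs → xs ⊆∼ zs
⊆∼-trans xs⊆ys ys⊆zs =
  All.map (All.lookupWith (λ y-in-zs x∼y → Any.map (∼-trans x∼y) y-in-zs) ys⊆zs) xs⊆ys

≋-sym : ∀ {xs ys} → xs ≋ ys → ys ≋ xs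
≋-sym (xs⊆ys , ys⊆xs) = ys⊆xs , xs⊆ys

≋-trans : ∀ {xs ys zs} → xs ≋ ys → ys ≋ zs → xs ≋ zs
≋-trans (xs⊆ys , ys⊆xs) (ys⊆zs , zs⊆ys) = ⊆∼-trans xs⊆ys ys⊆zs , ⊆∼-trans zs⊆ys ys⊆xs

Pointwise⇒≋ : ∀ {xs ys} → Pointwise _∼_ xs ys → xs ≋ ys
Pointwise⇒≋ xs∼ys = Pointwise⇒⊆∼ xs∼ys , Pointwise⇒⊆∼ (Pointwise.symmetric ∼-sym xs∼ys)
  where
  Pointwise⇒⊆∼ : ∀ {xs ys} → Pointwise _∼_ xs ys → xs ⊆∼ ys
  Pointwise⇒⊆∼ []            = []
  Pointwise⇒⊆∼ (x∼y ∷ xs∼ys) = here x∼y ∷ All.map there (Pointwise⇒⊆∼ xs∼ys)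

↭⇒≋ : ∀ {xs ys} → xs ↭ ys → xs ≋ ys
↭⇒≋ xs↭ys = ↭⇒⊆∼ xs↭ys , ↭⇒⊆∼ (↭-sym xs↭ys)
  where
  ↭⇒⊆∼ : ∀ {xs ys} → xs ↭ ys → xs ⊆∼ ys
  ↭⇒⊆∼ xs↭ys = All.tabulate λ x∈xs → Any.map ∼-reflexive (∈-resp-↭ xs↭ys x∈xs)

≋-reflexive : ∀ {xs ys} → xs ≡ ys → xs ≋ ys
≋-reflexive refl = ↭⇒≋ ↭-refl

map-≋ : ∀ {f} → Projective f → ∀ {xs ys} → xs ≋ ys → map f xs ≋ map f ys
map-≋ {f} f-projective (xs⊆ys , ys⊆xs) = map-⊆∼ xs⊆ys , map-⊆∼ ys⊆xs
  where
  map-⊆∼ : ∀ {xs ys} → xs ⊆∼ ys → map f xs ⊆∼ map f ys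
  map-⊆∼ = All.map⁺ ∘ All.map (Any.map⁺ ∘ Any.map f-projective)

map-∼-≋ : ∀ {f g : Pair → Pair} → (∀ x → f x ∼ g x) → ∀ xs → map f xs ≋ map g xs
map-∼-≋ {f} {g} f∼g xs = Pointwise⇒≋ (pointwise xs)
  where
  pointwise : ∀ xs → Pointwise _∼_ (map f xs) (map g xs)
  pointwise []       = []
  pointwise (x ∷ xs) = f∼g x ∷ pointwise xs

SameSet-resp-≋ : ∀ {xs ys zs} → SameSet xs ys → ys ≋ zs → SameSet xs zs
SameSet-resp-≋ (xs-in-ys , ys-in-xs) (ys⊆zs , zs⊆ys) =
  All.map (λ {x} → All.lookupWith (λ y-in-zs x≈y → Any.map (≈P-respʳ-∼ x x≈y) y-in-zs) ys⊆zs) xs-in-ys ,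
  All.map (All.lookupWith (λ y-in-xs z∼y → Any.map (λ {a} y≈a → ≈P-respˡ-∼ a y≈a (∼-sym z∼y)) y-in-xs)
                          ys-in-xs) zs⊆ys

record Mat : Set where
  constructor mat
  field
    a b c d : ℤσ

mat-cong : ∀ {a b c d a′ b′ c′ d′} → a ≡ a′ → b ≡ b′ → c ≡ c′ → d ≡ d′ →
           mat a b c d ≡ mat a′ b′ c′ d′
mat-cong refl refl refl refl = refl

app : Mat → Pair → Pair
app (mat a b c d) (p , q) = (a *σ p +σ b *σ q , c *σ p +σ d *σ q)

det : Mat → ℤσ
det (mat a b c d) = a *σ d -σ b *σ c

idM : Mat
idM = mat 1σ 0σ 0σ 1σ

infixl 7 _⊗_
_⊗_ : Mat → Mat → Mat
mat a b c d ⊗ mat e f g h = mat (a *σ e +σ b *σ g) (a *σ f +σ b *σ h) (c *σ e +σ d *σ g) (c *σ f +σ d *σ h)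

infixr 7 _·M_
_·M_ : ℤσ → Mat → Mat
k ·M mat a b c d = mat (k *σ a) (k *σ b) (k *σ c) (k *σ d)

conjM : Mat → Mat
conjM (mat a b c d) = mat (conj a) (conj b) (conj c) (conj d)

app-idM : ∀ x → app idM x ≡ x
app-idM (p , q) = cong₂ _,_ (first p q) (second p q)
  where
  first : ∀ p q → 1σ *σ p +σ 0σ *σ q ≡ p
  first = solve-∀ ℤσ-ring
  second : ∀ p q → 0σ *σ p +σ 1σ *σ q ≡ q
  second = solve-∀ ℤσ-ring

app-⊗ : ∀ M N x → app (M ⊗ N) x ≡ app M (app N x)
app-⊗ (mat a b c d) (mat e f g h) (p , q) = cong₂ _,_ (row a b e f g h p q) (row c d e f g h p q)
  where
  row : ∀ a b e f g h p q →
    (a *σ e +σ b *σ g) *σ p +σ (a *σ f +σ b *σ h) *σ q ≡ a *σ (e *σ p +σ f *σ q) +σ b *σ (g *σ p +σ h *σ q)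
  row = solve-∀ ℤσ-ring

app-·M : ∀ k M x → app (k ·M M) x ≡ k ·P app M x
app-·M k (mat a b c d) (p , q) = cong₂ _,_ (row k a b p q) (row k c d p q)
  where
  row : ∀ k a b p q → (k *σ a) *σ p +σ (k *σ b) *σ q ≡ k *σ (a *σ p +σ b *σ q)
  row = solve-∀ ℤσ-ring

app-·P : ∀ M c x → app M (c ·P x) ≡ c ·P app M x
app-·P (mat a b c d) k (p , q) = cong₂ _,_ (pull-scalar a b k p q) (pull-scalar c d k p q)
  where
  pull-scalar : ∀ a b k p q → a *σ (k *σ p) +σ b *σ (k *σ q) ≡ k *σ (a *σ p +σ b *σ q)
  pull-scalar = solve-∀ ℤσ-ring

app-+P : ∀ M x y → app M (x +P y) ≡ app M x +P app M y
app-+P (mat a b c d) (p , q) (r , s) = cong₂ _,_ (distribute a b p q r s) (distribute c d p q r s)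
  where
  distribute : ∀ a b p q r s → a *σ (p +σ r) +σ b *σ (q +σ s) ≡ (a *σ p +σ b *σ q) +σ (a *σ r +σ b *σ s)
  distribute = solve-∀ ℤσ-ring

conjP-app : ∀ M x → conjP (app M x) ≡ app (conjM M) (conjP x)
conjP-app (mat a b c d) (p , q) = cong₂ _,_ (conj-row a b) (conj-row c d)
  where
  conj-row : ∀ a b → conj (a *σ p +σ b *σ q) ≡ conj a *σ conj p +σ conj b *σ conj q
  conj-row a b = trans (conj-+σ (a *σ p) (b *σ q)) (cong₂ _+σ_ (conj-*σ a p) (conj-*σ b q))

app-projective : ∀ M → Projective (app M)
app-projective M = semilinear⇒projective (λ c → c) (λ c≢0 → c≢0) (app-·P M)

cross-app : ∀ M x y → cross (app M x) (app M y) ≡ det M *σ cross x y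
cross-app (mat a b c d) (p , q) (r , s) = multiplicative a b c d p q r s
  where
  multiplicative : ∀ a b c d p q r s →
    (a *σ p +σ b *σ q) *σ (c *σ r +σ d *σ s) -σ (c *σ p +σ d *σ q) *σ (a *σ r +σ b *σ s) ≡
    (a *σ d -σ b *σ c) *σ (p *σ s -σ q *σ r)
  multiplicative = solve-∀ ℤσ-ring

frame : Pair → Pair → List Pair
frame P R = P ∷ R ∷ P +P R ∷ P +P σ′ ·P R ∷ []

vertices : List Pair
vertices = pt0 ∷ pt1 ∷ ptσ ∷ pt∞ ∷ []

vertices≋frame : vertices ≋ frame pt0 pt∞
vertices≋frame = ↭⇒≋ (prep pt0 (shift pt∞ (pt1 ∷ ptσ ∷ []) []))

map-app-frame : ∀ M P R → map (app M) (frame P R) ≡ frame (app M P) (app M R)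
map-app-frame M P R = cong₂ (λ u v → app M P ∷ app M R ∷ u ∷ v ∷ [])
  (app-+P M P R) (trans (app-+P M P (σ′ ·P R)) (cong (app M P +P_) (app-·P M σ′ R)))

conj-cross : ∀ x y → conj (cross x y) ≡ cross (conjP x) (conjP y)
conj-cross (p , q) (r , s) = begin
  conj (p *σ s -σ q *σ r)                 ≡⟨ conj-+σ (p *σ s) (-σ (q *σ r)) ⟩
  conj (p *σ s) +σ conj (-σ (q *σ r))     ≡⟨ cong (conj (p *σ s) +σ_) (conj-neg (q *σ r)) ⟩
  conj (p *σ s) -σ conj (q *σ r)          ≡⟨ cong₂ _-σ_ (conj-*σ p s) (conj-*σ q r) ⟩
  conj p *σ conj s -σ conj q *σ conj r    ∎

-- Complex conjugation fixes 0, 1 and ∞ but sends σ to 1 - σ, so it maps the frame (P, R)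
-- to the frame (P̄ + R̄, -R̄), up to order and sign.
conjP-frame : ∀ P R → map conjP (frame P R) ≋ frame (conjP P +P conjP R) (-P conjP R)
conjP-frame (p , q) (r , s) = ≋-trans (↭⇒≋ swap-first-and-third) (Pointwise⇒≋
  (∼-reflexive (cong₂ _,_ (conj-+σ p r) (conj-+σ q s))
  ∷ ∼-by (-σ 1σ) (λ ()) (cong₂ _,_ (double-neg (conj r)) (double-neg (conj s)))
  ∷ ∼-reflexive (cong₂ _,_ (add-sub (conj p) (conj r)) (add-sub (conj q) (conj s)))
  ∷ ∼-reflexive (cong₂ _,_ (conj-σ-shear p r) (conj-σ-shear q s))
  ∷ []))
  where
  swap-first-and-third : ∀ {A B C D : Pair} → A ∷ B ∷ C ∷ D ∷ [] ↭ C ∷ B ∷ A ∷ D ∷ []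
  swap-first-and-third {A} {B} {C} {D} =
    ↭-trans (swap A B ↭-refl) (↭-trans (prep B (swap A C ↭-refl)) (swap B C ↭-refl))
  double-neg : ∀ a → a ≡ (-σ 1σ) *σ (-σ a)
  double-neg = solve-∀ ℤσ-ring
  add-sub : ∀ a b → a ≡ (a +σ b) +σ -σ b
  add-sub = solve-∀ ℤσ-ring
  σ̄-shear : ∀ a b → a +σ conj σ′ *σ b ≡ (a +σ b) +σ σ′ *σ (-σ b)
  σ̄-shear = solve-∀ ℤσ-ring
  conj-σ-shear : ∀ a b → conj (a +σ σ′ *σ b) ≡ (conj a +σ conj b) +σ σ′ *σ (-σ conj b)
  conj-σ-shear a b = begin
    conj (a +σ σ′ *σ b)                        ≡⟨ conj-+σ a (σ′ *σ b) ⟩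
    conj a +σ conj (σ′ *σ b)                   ≡⟨ cong (conj a +σ_) (conj-*σ σ′ b) ⟩
    conj a +σ conj σ′ *σ conj b                ≡⟨ σ̄-shear (conj a) (conj b) ⟩
    (conj a +σ conj b) +σ σ′ *σ (-σ conj b)    ∎

cross-shear : ∀ P R → cross (P +P R) (-P R) ≡ -σ cross P R
cross-shear (p , q) (r , s) = shear p q r s
  where
  shear : ∀ p q r s → (p +σ r) *σ (-σ s) -σ (q +σ s) *σ (-σ r) ≡ -σ (p *σ s -σ q *σ r)
  shear = solve-∀ ℤσ-ring

UnimodularFrame : List Pair → Set
UnimodularFrame xs = Σ Pair λ P → Σ Pair λ R → norm (cross P R) ≡ + 1 × xs ≋ frame P R

-- The vertices of a tetrahedron hT form a unimodular frame

-- The matrix of the fourth reflection is divided by -1 + 2σ to make its determinant a unit.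
reflectionMatrix : Fin 4 → Mat
reflectionMatrix zero                    = mat 1σ 0σ 0σ 1σ
reflectionMatrix (suc zero)              = mat (mk -[1+ 0 ] (+ 1)) 0σ 0σ 1σ
reflectionMatrix (suc (suc zero))        = mat (mk (+ 0) -[1+ 0 ]) (mk (+ 1) (+ 1)) 0σ 1σ
reflectionMatrix (suc (suc (suc zero)))  = mat (mk (+ 1) -[1+ 0 ]) 0σ (mk (+ 1) -[1+ 1 ]) σ′

det-reflectionMatrix : ∀ i → norm (det (reflectionMatrix i)) ≡ + 1
det-reflectionMatrix zero                   = refl
det-reflectionMatrix (suc zero)             = refl
det-reflectionMatrix (suc (suc zero))       = refl
det-reflectionMatrix (suc (suc (suc zero))) = refl

reflection-∼ : ∀ i x → reflection i x ∼ app (reflectionMatrix i) (conjP x)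
reflection-∼ zero                   x       = ∼-reflexive refl
reflection-∼ (suc zero)             x       = ∼-reflexive refl
reflection-∼ (suc (suc zero))       x       = ∼-reflexive refl
reflection-∼ (suc (suc (suc zero))) (p , q) =
  ∼-by (mk -[1+ 0 ] (+ 2)) (λ ()) (cong₂ _,_ (first-row (conj p) (conj q)) (second-row (conj p) (conj q)))
  where
  first-row : ∀ p q →
    mk (+ 1) (+ 1) *σ p +σ 0σ *σ q ≡ mk -[1+ 0 ] (+ 2) *σ (mk (+ 1) -[1+ 0 ] *σ p +σ 0σ *σ q)
  first-row = solve-∀ ℤσ-ring
  second-row : ∀ p q →
    mk (+ 3) (+ 0) *σ p +σ mk -[1+ 1 ] (+ 1) *σ q ≡ mk -[1+ 0 ] (+ 2) *σ (mk (+ 1) -[1+ 1 ] *σ p +σ σ′ *σ q)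
  second-row = solve-∀ ℤσ-ring

reflection-projective : ∀ i → Projective (reflection i)
reflection-projective i = pointwise-∼⇒projective {g = app (reflectionMatrix i) ∘ conjP} (reflection-∼ i)
  (λ x∼y → app-projective (reflectionMatrix i) (conjP-projective x∼y))

antilinear-unimodularFrame : ∀ A P R → norm (det A) ≡ + 1 → norm (cross P R) ≡ + 1 →
  UnimodularFrame (map (app A) (map conjP (frame P R)))
antilinear-unimodularFrame A P R det-unit cross-unit = app A P̄′ , app A R̄′ , unimodular , image
  where
  P̄′ R̄′ : Pair
  P̄′ = conjP P +P conjP R
  R̄′ = -P conjP R
  image : map (app A) (map conjP (frame P R)) ≋ frame (app A P̄′) (app A R̄′)
  image = subst (map (app A) (map conjP (frame P R)) ≋_) (map-app-frame A P̄′ R̄′)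
                (map-≋ (app-projective A) (conjP-frame P R))
  unimodular : norm (cross (app A P̄′) (app A R̄′)) ≡ + 1
  unimodular = begin
    norm (cross (app A P̄′) (app A R̄′))          ≡⟨ cong norm (cross-app A P̄′ R̄′) ⟩
    norm (det A *σ cross P̄′ R̄′)                 ≡⟨ norm-*σ (det A) (cross P̄′ R̄′) ⟩
    norm (det A) ℤ.* norm (cross P̄′ R̄′)         ≡⟨ cong (λ v → v ℤ.* norm (cross P̄′ R̄′)) det-unit ⟩
    + 1 ℤ.* norm (cross P̄′ R̄′)                  ≡⟨ ℤ.*-identityˡ (norm (cross P̄′ R̄′)) ⟩
    norm (cross P̄′ R̄′)                          ≡⟨ cong norm (cross-shear (conjP P) (conjP R)) ⟩
    norm (-σ cross (conjP P) (conjP R))          ≡⟨ norm-neg (cross (conjP P) (conjP R)) ⟩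
    norm (cross (conjP P) (conjP R))             ≡⟨ cong norm (conj-cross P R) ⟨
    norm (conj (cross P R))                      ≡⟨ norm-conj (cross P R) ⟩
    norm (cross P R)                             ≡⟨ cross-unit ⟩
    + 1                                          ∎

reflection-unimodularFrame : ∀ i xs → UnimodularFrame xs → UnimodularFrame (map (reflection i) xs)
reflection-unimodularFrame i xs (P , R , cross-unit , xs≋PR) =
  let (P′ , R′ , cross′-unit , image≋P′R′) =
        antilinear-unimodularFrame (reflectionMatrix i) P R (det-reflectionMatrix i) cross-unit
  in P′ , R′ , cross′-unit ,
     ≋-trans (map-≋ (reflection-projective i) xs≋PR) (≋-trans (map-∼-≋ (reflection-∼ i) (frame P R)) image≋P′R′)

tetrahedron-unimodularFrame : ∀ h → UnimodularFrame (map (act h) vertices)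
tetrahedron-unimodularFrame []      = pt0 , pt∞ , refl , vertices≋frame
tetrahedron-unimodularFrame (i ∷ h) =
  reflection-unimodularFrame i (map (act h) vertices) (tetrahedron-unimodularFrame h)

-- Generators of the symmetry group of the tessellation: the reflections in the faces of T, and
-- the mirror symmetries z ↦ σ z̄, z ↦ 1 - z̄ and z ↦ 1 / z̄ of T itself, which permute its vertices.
data Gen : Set where
  face   : Fin 4 → Gen
  mirror : Fin 3 → Gen

genMatrix : Gen → Mat
genMatrix (face i)                  = reflectionMatrix i
genMatrix (mirror zero)             = mat σ′ 0σ 0σ 1σ
genMatrix (mirror (suc zero))       = mat (mk -[1+ 0 ] (+ 0)) 1σ 0σ 1σ
genMatrix (mirror (suc (suc zero))) = mat 0σ 1σ 1σ 0σ

gen : Gen → Pair → Pair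
gen g x = app (genMatrix g) (conjP x)

actᴱ : List Gen → Pair → Pair
actᴱ []      x = x
actᴱ (g ∷ w) x = gen g (actᴱ w x)

gen-projective : ∀ g → Projective (gen g)
gen-projective g x∼y = app-projective (genMatrix g) (conjP-projective x∼y)

actᴱ-projective : ∀ w → Projective (actᴱ w)
actᴱ-projective []      x∼y = x∼y
actᴱ-projective (g ∷ w) x∼y = gen-projective g (actᴱ-projective w x∼y)

act-∼-faces : ∀ h x → act h x ∼ actᴱ (map face h) x
act-∼-faces []      x = ∼-reflexive refl
act-∼-faces (i ∷ h) x = ∼-trans (reflection-∼ i (act h x)) (gen-projective (face i) (act-∼-faces h x))

-- A composite of generators is x ↦ M x (parity false) or x ↦ M x̄ (parity true).
semiApp : Mat × Bool → Pair → Pair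
semiApp (M , false) x = app M x
semiApp (M , true)  x = app M (conjP x)

matrixOf : List Gen → Mat × Bool
matrixOf []      = idM , false
matrixOf (g ∷ w) = genMatrix g ⊗ conjM (proj₁ (matrixOf w)) , not (proj₂ (matrixOf w))

gen-semiApp : ∀ g M b x → gen g (semiApp (M , b) x) ≡ semiApp (genMatrix g ⊗ conjM M , not b) x
gen-semiApp g M false x = begin
  app (genMatrix g) (conjP (app M x))             ≡⟨ cong (app (genMatrix g)) (conjP-app M x) ⟩
  app (genMatrix g) (app (conjM M) (conjP x))     ≡⟨ app-⊗ (genMatrix g) (conjM M) (conjP x) ⟨
  app (genMatrix g ⊗ conjM M) (conjP x)           ∎
gen-semiApp g M true x = begin
  app (genMatrix g) (conjP (app M (conjP x)))             ≡⟨ cong (app (genMatrix g)) (conjP-app M (conjP x)) ⟩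
  app (genMatrix g) (app (conjM M) (conjP (conjP x)))     ≡⟨ cong (app (genMatrix g) ∘ app (conjM M)) (conjP-involutive x) ⟩
  app (genMatrix g) (app (conjM M) x)                     ≡⟨ app-⊗ (genMatrix g) (conjM M) x ⟨
  app (genMatrix g ⊗ conjM M) x                           ∎

actᴱ-matrixOf : ∀ w x → actᴱ w x ≡ semiApp (matrixOf w) x
actᴱ-matrixOf []      x = sym (app-idM x)
actᴱ-matrixOf (g ∷ w) x =
  trans (cong (gen g) (actᴱ-matrixOf w x)) (gen-semiApp g (proj₁ (matrixOf w)) (proj₂ (matrixOf w)) x)

-- Conjugating the reflection in face i by mirror j gives the reflection in face (facePermutation j i),
-- up to the scalar unit (conjugationUnit j i).
facePermutation : Fin 3 → Fin 4 → Fin 4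
facePermutation zero             zero             = suc zero
facePermutation zero             (suc zero)       = zero
facePermutation zero             i                = i
facePermutation (suc zero)       (suc zero)       = suc (suc zero)
facePermutation (suc zero)       (suc (suc zero)) = suc zero
facePermutation (suc zero)       i                = i
facePermutation (suc (suc zero)) (suc (suc zero))       = suc (suc (suc zero))
facePermutation (suc (suc zero)) (suc (suc (suc zero))) = suc (suc zero)
facePermutation (suc (suc zero)) i                      = i

conjugationUnit : Fin 3 → Fin 4 → Fin 6
conjugationUnit zero             (suc (suc (suc zero))) = suc (suc (suc (suc zero)))
conjugationUnit (suc (suc zero)) (suc zero)             = suc (suc (suc (suc zero)))
conjugationUnit (suc (suc zero)) (suc (suc zero))       = suc zero
conjugationUnit (suc (suc zero)) (suc (suc (suc zero))) = suc zero
conjugationUnit _                _                      = zero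

mirror-face-matrix : ∀ j i → matrixOf (mirror j ∷ face i ∷ []) ≡
  (unit (conjugationUnit j i) ·M proj₁ (matrixOf (face (facePermutation j i) ∷ mirror j ∷ [])) , false)
mirror-face-matrix zero             zero                   = refl
mirror-face-matrix zero             (suc zero)             = refl
mirror-face-matrix zero             (suc (suc zero))       = refl
mirror-face-matrix zero             (suc (suc (suc zero))) = refl
mirror-face-matrix (suc zero)       zero                   = refl
mirror-face-matrix (suc zero)       (suc zero)             = refl
mirror-face-matrix (suc zero)       (suc (suc zero))       = refl
mirror-face-matrix (suc zero)       (suc (suc (suc zero))) = refl
mirror-face-matrix (suc (suc zero)) zero                   = refl
mirror-face-matrix (suc (suc zero)) (suc zero)             = refl
mirror-face-matrix (suc (suc zero)) (suc (suc zero))       = refl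
mirror-face-matrix (suc (suc zero)) (suc (suc (suc zero))) = refl

mirror-face-∼ : ∀ j i x → gen (mirror j) (gen (face i) x) ∼ gen (face (facePermutation j i)) (gen (mirror j) x)
mirror-face-∼ j i x = ∼-by u (norm≡1⇒nonzero u (norm-unit (conjugationUnit j i))) (begin
  actᴱ (mirror j ∷ face i ∷ []) x          ≡⟨ actᴱ-matrixOf (mirror j ∷ face i ∷ []) x ⟩
  semiApp (matrixOf (mirror j ∷ face i ∷ [])) x
                                           ≡⟨ cong (λ N → semiApp N x) (mirror-face-matrix j i) ⟩
  app (u ·M M′) x                          ≡⟨ app-·M u M′ x ⟩
  u ·P app M′ x
    ≡⟨ cong (u ·P_) (actᴱ-matrixOf (face (facePermutation j i) ∷ mirror j ∷ []) x) ⟨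
  u ·P actᴱ (face (facePermutation j i) ∷ mirror j ∷ []) x ∎)
  where
  u : ℤσ
  u = unit (conjugationUnit j i)
  M′ : Mat
  M′ = proj₁ (matrixOf (face (facePermutation j i) ∷ mirror j ∷ []))

mirror-faces-∼ : ∀ j h y →
  gen (mirror j) (actᴱ (map face h) y) ∼ actᴱ (map face (map (facePermutation j) h)) (gen (mirror j) y)
mirror-faces-∼ j []      y = ∼-reflexive refl
mirror-faces-∼ j (i ∷ h) y =
  ∼-trans (mirror-face-∼ j i (actᴱ (map face h) y)) (gen-projective (face (facePermutation j i)) (mirror-faces-∼ j h y))

FacesThenMirrors : List Gen → Set
FacesThenMirrors w = Σ Word λ h → Σ (List (Fin 3)) λ τ → ∀ x → actᴱ w x ∼ actᴱ (map face h) (actᴱ (map mirror τ) x)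

normal-form : ∀ w → FacesThenMirrors w
normal-form []             = [] , [] , λ x → ∼-reflexive refl
normal-form (face i ∷ w)   =
  let (h , τ , w∼hτ) = normal-form w in i ∷ h , τ , λ x → gen-projective (face i) (w∼hτ x)
normal-form (mirror j ∷ w) =
  let (h , τ , w∼hτ) = normal-form w in
  map (facePermutation j) h , j ∷ τ ,
  λ x → ∼-trans (gen-projective (mirror j) (w∼hτ x)) (mirror-faces-∼ j h (actᴱ (map mirror τ) x))

mirror-vertices : ∀ j → map (gen (mirror j)) vertices ≋ vertices
mirror-vertices zero = ≋-trans
  (Pointwise⇒≋ (∼-reflexive refl ∷ ∼-reflexive refl ∷ ∼-reflexive refl ∷ ∼-by σ′ (λ ()) refl ∷ []))
  (↭⇒≋ (prep pt0 (swap ptσ pt1 ↭-refl)))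
mirror-vertices (suc zero) = ≋-trans
  (Pointwise⇒≋ (∼-reflexive refl ∷ ∼-reflexive refl ∷ ∼-reflexive refl ∷ ∼-by (-σ 1σ) (λ ()) refl ∷ []))
  (↭⇒≋ (swap pt1 pt0 ↭-refl))
mirror-vertices (suc (suc zero)) = ≋-trans
  (Pointwise⇒≋ (∼-reflexive refl ∷ ∼-reflexive refl ∷ proportional σ′ 1σ (λ ()) (λ ()) refl
                ∷ ∼-reflexive refl ∷ []))
  (↭⇒≋ (↭-trans (shift pt0 (pt∞ ∷ pt1 ∷ ptσ ∷ []) []) (prep pt0 (↭-sym (shift pt∞ (pt1 ∷ ptσ ∷ []) [])))))

mirrors-vertices : ∀ τ → map (actᴱ (map mirror τ)) vertices ≋ vertices
mirrors-vertices []      = ↭⇒≋ ↭-refl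
mirrors-vertices (j ∷ τ) = ≋-trans (map-≋ (gen-projective (mirror j)) (mirrors-vertices τ)) (mirror-vertices j)

-- Unimodular matrices belong to the extended group

record Realized (M : Mat) : Set where
  constructor realized-by
  field
    word     : List Gen
    realizes : ∀ x → app M x ∼ actᴱ word x

realized-word : ∀ w {M} → matrixOf w ≡ (M , false) → Realized M
realized-word w w≡M =
  realized-by w λ x → ∼-reflexive (sym (trans (actᴱ-matrixOf w x) (cong (λ N → semiApp N x) w≡M)))

realized-⊗ : ∀ {M N} → Realized M → Realized N → Realized (M ⊗ N)
realized-⊗ {M} {N} (realized-by v M∼v) (realized-by w N∼w) = realized-by (v ++ w) λ x →
  ∼-trans (∼-reflexive (app-⊗ M N x))
    (∼-trans (app-projective M (N∼w x)) (∼-trans (M∼v (actᴱ w x)) (∼-reflexive (actᴱ-++ v w x))))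
  where
  actᴱ-++ : ∀ v w x → actᴱ v (actᴱ w x) ≡ actᴱ (v ++ w) x
  actᴱ-++ []      w x = refl
  actᴱ-++ (g ∷ v) w x = cong (gen g) (actᴱ-++ v w x)

realized-resp-∼ : ∀ {M N} → (∀ x → app M x ∼ app N x) → Realized N → Realized M
realized-resp-∼ M∼N (realized-by w N∼w) = realized-by w λ x → ∼-trans (M∼N x) (N∼w x)

translation : ℤσ → Mat
translation u = mat 1σ u 0σ 1σ

dilation : ℤσ → Mat
dilation u = mat u 0σ 0σ 1σ

inversion : Mat
inversion = mat 0σ 1σ (-σ 1σ) 0σ

translation-realized : ∀ k → Realized (translation (unit k))
translation-realized k = realized-word (word k) (word≡ k)
  where
  word : Fin 6 → List Gen
  word zero                               = mirror (suc zero) ∷ mirror zero ∷ face zero ∷ face (suc zero) ∷ []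
  word (suc zero)                         = mirror zero ∷ mirror (suc zero) ∷ face (suc zero) ∷ face zero ∷ []
  word (suc (suc zero))                   = mirror (suc zero) ∷ mirror zero ∷ face (suc (suc zero)) ∷ face zero ∷ []
  word (suc (suc (suc zero)))             = mirror zero ∷ mirror (suc zero) ∷ face zero ∷ face (suc (suc zero)) ∷ []
  word (suc (suc (suc (suc zero))))       = mirror (suc zero) ∷ mirror zero ∷ face (suc zero) ∷ face (suc (suc zero)) ∷ []
  word (suc (suc (suc (suc (suc zero))))) = mirror zero ∷ mirror (suc zero) ∷ face (suc (suc zero)) ∷ face (suc zero) ∷ []
  word≡ : ∀ k → matrixOf (word k) ≡ (translation (unit k) , false)
  word≡ zero                               = refl
  word≡ (suc zero)                         = refl
  word≡ (suc (suc zero))                   = refl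
  word≡ (suc (suc (suc zero)))             = refl
  word≡ (suc (suc (suc (suc zero))))       = refl
  word≡ (suc (suc (suc (suc (suc zero))))) = refl

dilation-realized : ∀ k → Realized (dilation (unit k))
dilation-realized k = realized-word (word k) (word≡ k)
  where
  word : Fin 6 → List Gen
  word zero                               = []
  word (suc zero)                         = mirror zero ∷ face zero ∷ []
  word (suc (suc zero))                   = face (suc zero) ∷ face zero ∷ []
  word (suc (suc (suc zero)))             = mirror zero ∷ face zero ∷ face (suc zero) ∷ face zero ∷ []
  word (suc (suc (suc (suc zero))))       = face zero ∷ face (suc zero) ∷ []
  word (suc (suc (suc (suc (suc zero))))) = mirror zero ∷ face (suc zero) ∷ []
  word≡ : ∀ k → matrixOf (word k) ≡ (dilation (unit k) , false)
  word≡ zero                               = refl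
  word≡ (suc zero)                         = refl
  word≡ (suc (suc zero))                   = refl
  word≡ (suc (suc (suc zero)))             = refl
  word≡ (suc (suc (suc (suc zero))))       = refl
  word≡ (suc (suc (suc (suc (suc zero))))) = refl

inversion-realized : Realized inversion
inversion-realized = realized-word (mirror (suc (suc zero)) ∷ mirror zero ∷ face zero ∷ face (suc zero) ∷ []) refl

Unimodular : Mat → Set
Unimodular M = norm (det M) ≡ + 1

columnOp : ℤσ → Mat → Mat
columnOp u (mat r p s q) = mat r (p -σ u *σ r) s (q -σ u *σ s)

columnOp-⊗-translation : ∀ u M → columnOp u M ⊗ translation u ≡ M
columnOp-⊗-translation u (mat r p s q) = mat-cong (first r p u) (second r p u) (first s q u) (second s q u)
  where
  first : ∀ r p u → r *σ 1σ +σ (p -σ u *σ r) *σ 0σ ≡ r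
  first = solve-∀ ℤσ-ring
  second : ∀ r p u → r *σ u +σ (p -σ u *σ r) *σ 1σ ≡ p
  second = solve-∀ ℤσ-ring

det-columnOp : ∀ u M → det (columnOp u M) ≡ det M
det-columnOp u (mat r p s q) = invariant r p s q u
  where
  invariant : ∀ r p s q u → r *σ (q -σ u *σ s) -σ (p -σ u *σ r) *σ s ≡ r *σ q -σ p *σ s
  invariant = solve-∀ ℤσ-ring

swapColumns : Mat → Mat
swapColumns (mat r p s q) = mat p (-σ r) q (-σ s)

swapColumns-⊗-inversion : ∀ M → swapColumns M ⊗ inversion ≡ M
swapColumns-⊗-inversion (mat r p s q) = mat-cong (first p r) (second p r) (first q s) (second q s)
  where
  first : ∀ p r → p *σ 0σ +σ (-σ r) *σ (-σ 1σ) ≡ r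
  first = solve-∀ ℤσ-ring
  second : ∀ p r → p *σ 1σ +σ (-σ r) *σ 0σ ≡ p
  second = solve-∀ ℤσ-ring

det-swapColumns : ∀ M → det (swapColumns M) ≡ det M
det-swapColumns (mat r p s q) = invariant r p s q
  where
  invariant : ∀ r p s q → p *σ (-σ s) -σ (-σ r) *σ q ≡ r *σ q -σ p *σ s
  invariant = solve-∀ ℤσ-ring

realized-diagonal : ∀ r q → norm r ≡ + 1 → norm q ≡ + 1 → Realized (mat r 0σ 0σ q)
realized-diagonal r q r-unit q-unit = from-unit (norm≡1⇒unit (r *σ conj q) rq̄-unit)
  where
  rq̄-unit : norm (r *σ conj q) ≡ + 1
  rq̄-unit = trans (norm-*σ r (conj q)) (cong₂ ℤ._*_ r-unit (trans (norm-conj q) q-unit))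
  qq̄≡1 : q *σ conj q ≡ 1σ
  qq̄≡1 = trans (*σ-conj q) (cong fromℤ q-unit)
  rescale : ∀ x → app (mat r 0σ 0σ q) x ∼ app (dilation (r *σ conj q)) x
  rescale (a , b) = proportional (conj q) 1σ (conj-nonzero (norm≡1⇒nonzero q q-unit)) (λ ())
    (cong₂ _,_ (first r (conj q) a b) (begin
      conj q *σ (0σ *σ a +σ q *σ b)       ≡⟨ regroup q (conj q) a b ⟩
      (q *σ conj q) *σ b                  ≡⟨ cong (_*σ b) qq̄≡1 ⟩
      1σ *σ b                             ≡⟨ ungroup a b ⟩
      1σ *σ (0σ *σ a +σ 1σ *σ b)          ∎))
    where
    first : ∀ r q̄ a b → q̄ *σ (r *σ a +σ 0σ *σ b) ≡ 1σ *σ ((r *σ q̄) *σ a +σ 0σ *σ b)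
    first = solve-∀ ℤσ-ring
    regroup : ∀ q q̄ a b → q̄ *σ (0σ *σ a +σ q *σ b) ≡ (q *σ q̄) *σ b
    regroup = solve-∀ ℤσ-ring
    ungroup : ∀ a b → 1σ *σ b ≡ 1σ *σ (0σ *σ a +σ 1σ *σ b)
    ungroup = solve-∀ ℤσ-ring
  from-unit : Σ (Fin 6) (λ k → r *σ conj q ≡ unit k) → Realized (mat r 0σ 0σ q)
  from-unit (k , rq̄≡u) = realized-resp-∼ rescale (subst (λ u → Realized (dilation u)) (sym rq̄≡u) (dilation-realized k))

realized-unitTriangular : ∀ r q → norm r ≡ + 1 → norm q ≡ + 1 → ∀ p → Realized (mat r p 0σ q)
realized-unitTriangular r q r-unit q-unit p = go q q-unit p (<-wellFounded (normℕ p))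
  where
  go : ∀ q → norm q ≡ + 1 → ∀ p → Acc _<_ (normℕ p) → Realized (mat r p 0σ q)
  go q q-unit p (acc rec) = by-cases (p ≟σ 0σ)
    where
    reduce : Σ (Fin 6) (λ k → normℕ (p -σ unit k *σ r) < normℕ p) → Realized (mat r p 0σ q)
    reduce (k , smaller) = subst Realized (columnOp-⊗-translation (unit k) (mat r p 0σ q))
      (realized-⊗ (go (q -σ unit k *σ 0σ) (trans (cong norm (sub-zero q (unit k))) q-unit) (p -σ unit k *σ r) (rec smaller))
                  (translation-realized k))
      where
      sub-zero : ∀ q u → q -σ u *σ 0σ ≡ q
      sub-zero = solve-∀ ℤσ-ring
    by-cases : Dec (p ≡ 0σ) → Realized (mat r p 0σ q)
    by-cases (yes p≡0) = subst (λ p → Realized (mat r p 0σ q)) (sym p≡0) (realized-diagonal r q r-unit q-unit)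
    by-cases (no p≢0)  = reduce (euclidean-step p r (norm≡1⇒nonzero r r-unit)
                                  (subst (_≤ normℕ p) (sym (cong ∣_∣ r-unit)) (normℕ>0 p≢0)))

realized-triangular : ∀ r p q → Unimodular (mat r p 0σ q) → Realized (mat r p 0σ q)
realized-triangular r p q unimodular =
  realized-unitTriangular r q (unit-factor r (ℕ.m*n≡1⇒m≡1 (normℕ r) (normℕ q) product≡1))
    (unit-factor q (ℕ.m*n≡1⇒n≡1 (normℕ r) (normℕ q) product≡1)) p
  where
  product≡1 : normℕ r * normℕ q ≡ 1
  product≡1 = ℤ.+-injective (begin
    + (normℕ r * normℕ q)             ≡⟨ ℤ.pos-* (normℕ r) (normℕ q) ⟩
    + normℕ r ℤ.* + normℕ q           ≡⟨ cong₂ ℤ._*_ (norm≡+normℕ r) (norm≡+normℕ q) ⟨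
    norm r ℤ.* norm q                 ≡⟨ norm-*σ r q ⟨
    norm (r *σ q)                     ≡⟨ cong norm (det-triangular r p q) ⟨
    norm (det (mat r p 0σ q))         ≡⟨ unimodular ⟩
    + 1                               ∎)
    where
    det-triangular : ∀ r p q → r *σ q -σ p *σ 0σ ≡ r *σ q
    det-triangular = solve-∀ ℤσ-ring
  unit-factor : ∀ u → normℕ u ≡ 1 → norm u ≡ + 1
  unit-factor u Nu≡1 = trans (norm≡+normℕ u) (cong +_ Nu≡1)

bottomRowSize : Mat → ℕ
bottomRowSize (mat _ _ s q) = normℕ s + normℕ q

-- Column operations reduce the bottom row as in the Euclidean algorithm until its first entry vanishes.
realized-unimodular : ∀ M → Unimodular M → Realized M
realized-unimodular M = go M (<-wellFounded (bottomRowSize M))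
  where
  reduce-by-translation : ∀ r p s q → s ≢ 0σ → normℕ s ≤ normℕ q →
    (∀ M′ → bottomRowSize M′ < normℕ s + normℕ q → Unimodular M′ → Realized M′) →
    Unimodular (mat r p s q) → Realized (mat r p s q)
  reduce-by-translation r p s q s≢0 s≤q recurse unimodular =
    let (k , smaller) = euclidean-step q s s≢0 s≤q in
    subst Realized (columnOp-⊗-translation (unit k) (mat r p s q))
      (realized-⊗ (recurse (columnOp (unit k) (mat r p s q)) (ℕ.+-monoʳ-< (normℕ s) smaller)
                           (trans (cong norm (det-columnOp (unit k) (mat r p s q))) unimodular))
                  (translation-realized k))
  go : ∀ M → Acc _<_ (bottomRowSize M) → Unimodular M → Realized M
  go (mat r p s q) (acc rec) unimodular = by-lower-left (s ≟σ 0σ)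
    where
    recurse : ∀ M′ → bottomRowSize M′ < normℕ s + normℕ q → Unimodular M′ → Realized M′
    recurse M′ smaller = go M′ (rec smaller)
    swapped : Unimodular (swapColumns (mat r p s q))
    swapped = trans (cong norm (det-swapColumns (mat r p s q))) unimodular
    size≡ : normℕ q + normℕ (-σ s) ≡ normℕ s + normℕ q
    size≡ = trans (cong (λ v → normℕ q + ∣ v ∣) (norm-neg s)) (ℕ.+-comm (normℕ q) (normℕ s))
    by-swapped-lower-left : Dec (q ≡ 0σ) → normℕ q < normℕ s → Realized (swapColumns (mat r p s q))
    by-swapped-lower-left (yes q≡0) _ =
      subst (λ q → Realized (mat p (-σ r) q (-σ s))) (sym q≡0)
        (realized-triangular p (-σ r) (-σ s) (subst (λ q → Unimodular (mat p (-σ r) q (-σ s))) q≡0 swapped))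
    by-swapped-lower-left (no q≢0) q<s =
      reduce-by-translation p (-σ r) q (-σ s) q≢0 (subst (normℕ q ≤_) (sym (cong ∣_∣ (norm-neg s))) (ℕ.<⇒≤ q<s))
        (λ M′ smaller → recurse M′ (subst (bottomRowSize M′ <_) size≡ smaller))
        swapped
    by-size : Dec (normℕ s ≤ normℕ q) → s ≢ 0σ → Realized (mat r p s q)
    by-size (yes s≤q) s≢0 = reduce-by-translation r p s q s≢0 s≤q recurse unimodular
    by-size (no s≰q)  _   = subst Realized (swapColumns-⊗-inversion (mat r p s q))
      (realized-⊗ (by-swapped-lower-left (q ≟σ 0σ) (ℕ.≰⇒> s≰q)) inversion-realized)
    by-lower-left : Dec (s ≡ 0σ) → Realized (mat r p s q)
    by-lower-left (yes s≡0) = subst (λ s → Realized (mat r p s q)) (sym s≡0)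
      (realized-triangular r p q (subst (λ s → Unimodular (mat r p s q)) s≡0 unimodular))
    by-lower-left (no s≢0)  = by-size (normℕ s ℕ.≤? normℕ q) s≢0

-- A unimodular frame is the vertex set of a tetrahedron hT

unimodularFrame-tetrahedron : ∀ P R → norm (cross P R) ≡ + 1 → Σ Word λ h → frame P R ≋ map (act h) vertices
unimodularFrame-tetrahedron (p , q) (r , s) unimodular = by-normal-form (normal-form w)
  where
  F : Mat
  F = mat r p s q
  F-realized : Realized F
  F-realized = realized-unimodular F (trans (cong norm (det≡-cross p q r s)) (trans (norm-neg (p *σ s -σ q *σ r)) unimodular))
    where
    det≡-cross : ∀ p q r s → r *σ q -σ p *σ s ≡ -σ (p *σ s -σ q *σ r)
    det≡-cross = solve-∀ ℤσ-ring
  w : List Gen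
  w = Realized.word F-realized
  frame≡ : frame (p , q) (r , s) ≡ map (app F) (frame pt0 pt∞)
  frame≡ = trans (cong₂ frame (cong₂ _,_ (second-column r p) (second-column s q))
                              (cong₂ _,_ (first-column r p) (first-column s q)))
                 (sym (map-app-frame F pt0 pt∞))
    where
    second-column : ∀ r p → p ≡ r *σ 0σ +σ p *σ 1σ
    second-column = solve-∀ ℤσ-ring
    first-column : ∀ r p → r ≡ r *σ 1σ +σ p *σ 0σ
    first-column = solve-∀ ℤσ-ring
  by-normal-form : FacesThenMirrors w → Σ Word λ h → frame (p , q) (r , s) ≋ map (act h) vertices
  by-normal-form (h , τ , w∼hτ) = h ,
    ≋-trans (≋-reflexive frame≡)
    (≋-trans (map-≋ (app-projective F) (≋-sym vertices≋frame))
    (≋-trans (map-∼-≋ (Realized.realizes F-realized) vertices)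
    (≋-trans (map-∼-≋ w∼hτ vertices)
    (≋-trans (map-≋ (actᴱ-projective (map face h)) (mirrors-vertices τ))
             (map-∼-≋ (λ x → ∼-sym (act-∼-faces h x)) vertices)))))

corollary3p15 : (α β γ δ : Pair) → IsPoint α → IsPoint β → IsPoint γ → IsPoint δ →
    FundamentalTetrahedron α β γ δ ⇔
      Σ ℤσ λ p → Σ ℤσ λ q → Σ ℤσ λ r → Σ ℤσ λ s →
        (norm (p *σ s -σ q *σ r) ≡ + 1) ×
        SameSet (α ∷ β ∷ γ ∷ δ ∷ [])
                ((p , q) ∷ (r , s) ∷ (p +σ r , q +σ s) ∷ (p +σ σ′ *σ r , q +σ σ′ *σ s) ∷ [])
corollary3p15 α β γ δ _ _ _ _ = mk⇔ tetrahedron⇒frame frame⇒tetrahedron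
  where
  FramedByUnimodularFrame : Set
  FramedByUnimodularFrame = Σ ℤσ λ p → Σ ℤσ λ q → Σ ℤσ λ r → Σ ℤσ λ s →
    norm (cross (p , q) (r , s)) ≡ + 1 × SameSet (α ∷ β ∷ γ ∷ δ ∷ []) (frame (p , q) (r , s))
  tetrahedron⇒frame : FundamentalTetrahedron α β γ δ → FramedByUnimodularFrame
  tetrahedron⇒frame (h , same) =
    let ((p , q) , (r , s) , unimodular , h≋frame) = tetrahedron-unimodularFrame h
    in p , q , r , s , unimodular , SameSet-resp-≋ same h≋frame
  frame⇒tetrahedron : FramedByUnimodularFrame → FundamentalTetrahedron α β γ δ
  frame⇒tetrahedron (p , q , r , s , unimodular , same) =
    let (h , frame≋h) = unimodularFrame-tetrahedron (p , q) (r , s) unimodular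
    in h , SameSet-resp-≋ same frame≋h
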